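{- Let $a,b$ be positive integers with $\gcd(a,b)=1$. For every partition $\pi\in\mathcal{D}_{b,-a}(a,b)$, $$\mathrm{word}(\zeta(\pi))=\mathrm{sw}^{+}_{b,-a}\circ\mathrm{rev}(\mathrm{word}(\pi)).$$
   Context: Words in $\{\mathrm{N},\mathrm{E}\}^*$ are identified with lattice paths from $(0,0)$ using unit north ($\mathrm{N}$) and east ($\mathrm{E}$) steps; $\mathrm{rev}$ reverses a word. A partition $\lambda$ with at most $a$ parts and largest part at most $b$ is identified with the set of unit squares of the rectangle $[0,b]\times[0,a]$ lying northwest of a path from $(0,0)$ to $(b,a)$ (English convention, rows left-justified and listed top to bottom); $\mathrm{word}(\lambda)$ is the word with $a$ letters $\mathrm{N}$ and $b$ letters $\mathrm{E}$ of this path, characterized by: the number of $\mathrm{E}$'s preceding the $j$-th $\mathrm{N}$ from the end equals the $j$-th largest part of $\lambda$ (parts padded by zeros to $a$ parts). The level of a lattice point $(x,y)$ is $by-ax$; a unit lattice square has the level of its southeast corner. $\mathcal{D}_{b,-a}(a,b)$ is the set of such partitions $\pi$ whose path visits only lattice points of level $\ge 0$. For such $\pi$, let $\Delta^c(\pi)$ be the set of levels of the unit squares in the rectangle lying southeast of the path of $\pi$ and above the line $by=ax$ (equivalently, having positive level); these levels are distinct positive integers. $\mathrm{sw}^+_{b,-a}$: for a word $u=u_1\cdots u_N$ set $l_0=0$, $l_i=l_{i-1}+b$ if $u_i=\mathrm{N}$, $l_i=l_{i-1}-a$ if $u_i=\mathrm{E}$; the output is obtained by taking $k=0$, then $k=-1,-2,-3,\dots$,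 then all positive $k$ in decreasing order, and for each $k$ scanning $u$ from left to right, appending each $u_i$ ($i\ge1$) with $l_i=k$. The hook of a cell $c$ of a partition diagram consists of $c$, the cells below $c$ in its column, and the cells right of $c$ in its row; $h(c)$ is its size. The map $\zeta$: let $\nu=f(\pi)$ be the unique partition whose first-column cells have hook lengths exactly the elements of $\Delta^c(\pi)$ (increasing from bottom to top). Then $\zeta(\pi)$ is the partition having one row for each row of $\nu$ whose first-column hook length equals the level of the unit square immediately east of some north step of the path of $\pi$; the length of that row of $\zeta(\pi)$ is the number of cells in the corresponding row of $\nu$ with hook length $\le b$, and rows keep the relative order of the corresponding rows of $\nu$. -}

module Defs where

open import Data.Nat using (ℕ; zero; suc; _+_; _*_; _∸_; _≤_; _<_; _≤?_; _<?_)
open import Data.Integer as ℤ using (ℤ; +_; -[1+_])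
open import Data.List using (List; []; _∷_; _++_; length; replicate; reverse; map;
  filter; concatMap; upTo)
open import Data.List.Relation.Unary.All using (All)
open import Data.List.Relation.Unary.Linked using (Linked)
open import Data.List.Relation.Unary.Any using (any?)
open import Data.Product using (_×_; _,_; proj₁; proj₂)
open import Data.Bool using (if_then_else_)
open import Relation.Nullary using (does)
open import Relation.Binary.PropositionalEquality using (_≡_)

data Step : Set where
  N E : Step

Word : Set
Word = List Step

rev : Word → Word
rev = reverse

-- Partitions in the a × b box
-- A partition is the list of its (positive) parts, weakly decreasing,
-- listed top to bottom (English convention).

record BoxPartition (a b : ℕ) (λ′ : List ℕ) : Set where
  field
    decreasing : Linked (λ x y → y ≤ x) λ′
    positive   : All (λ x → 0 < x) λ′
    fewRows    : length λ′ ≤ a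
    shortRows  : All (λ x → x ≤ b) λ′

padded : ℕ → List ℕ → List ℕ
padded a λ′ = λ′ ++ replicate (a ∸ length λ′) 0

-- builds E^{q₁-prev} N E^{q₂-q₁} N ... N E^{b-q_last}
-- from parts listed bottom to top
wordAux : ℕ → ℕ → List ℕ → Word
wordAux b prev []       = replicate (b ∸ prev) E
wordAux b prev (q ∷ qs) = replicate (q ∸ prev) E ++ (N ∷ wordAux b q qs)

-- word(λ): the number of E's preceding the j-th N from the end equals
-- the j-th largest part of λ (padded to a parts); b E's in total.
word : ℕ → ℕ → List ℕ → Word
word a b λ′ = wordAux b 0 (reverse (padded a λ′))

-- l_i for i ≥ 1 along the word, starting from l₀ (paired with the letter u_i)
levelsFrom : ℕ → ℕ → ℤ → Word → List (Step × ℤ)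
levelsFrom a b l []       = []
levelsFrom a b l (N ∷ u) = (N , l ℤ.+ + b) ∷ levelsFrom a b (l ℤ.+ + b) u
levelsFrom a b l (E ∷ u) = (E , l ℤ.- + a) ∷ levelsFrom a b (l ℤ.- + a) u

levels : ℕ → ℕ → Word → List (Step × ℤ)
levels a b = levelsFrom a b (+ 0)

-- level of lattice point (x , y) is b*y - a*x; the path of a word visits
-- (0,0) (level 0) and the points with levels l_i.
-- π ∈ 𝒟_{b,-a}(a,b)
InD : ℕ → ℕ → List ℕ → Set
InD a b π = BoxPartition a b π
          × All (λ p → + 0 ℤ.≤ proj₂ p) (levels a b (word a b π))

select : ℤ → List (Step × ℤ) → Word
select k []             = []
select k ((s , l) ∷ ps) =
  if does (l ℤ.≟ k) then s ∷ select k ps else select k ps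

-- k = 0, then k = -1, -2, ..., -(a·n), then k = b·n, ..., 2, 1,
-- where n = length u.  Since |l_i| ≤ a·n for l_i ≤ 0 and l_i ≤ b·n,
-- these ranges cover every level that occurs.
swPlus : ℕ → ℕ → Word → Word
swPlus a b u =
  select (+ 0) ps
  ++ concatMap (λ m → select -[1+ m ] ps) (upTo (a * length u))
  ++ concatMap (λ m → select (+ suc m) ps) (reverse (upTo (b * length u)))
  where
  ps = levels a b u

-- Δᶜ(π)
-- The unit square with lower-left corner (i , j) (0 ≤ i < b, 0 ≤ j < a)
-- has southeast corner (i+1 , j), hence level b*j - a*(i+1).  It lies
-- southeast of the path of π (i.e. is not a cell of π) iff the part of π
-- in the row [j , j+1] (the (j+1)-th padded part from the bottom) is ≤ i.
-- Δᶜ(π) collects the positive levels of such squares (as natural numbers).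

squaresRow : ℕ → ℕ → ℕ → ℕ → List ℕ
squaresRow a b j q =
  concatMap (λ i → if does (q ≤? i)
                   then (if does ((a * suc i) <? (b * j))
                         then (b * j ∸ a * suc i) ∷ []
                         else [])
                   else [])
            (upTo b)

-- bottom-to-top padded parts, with their row index j
squaresFrom : ℕ → ℕ → ℕ → List ℕ → List ℕ
squaresFrom a b j []       = []
squaresFrom a b j (q ∷ qs) = squaresRow a b j q ++ squaresFrom a b (suc j) qs

Δᶜ : ℕ → ℕ → List ℕ → List ℕ
Δᶜ a b π = squaresFrom a b 0 (reverse (padded a π))

-- Hook lengths
-- For a partition ν (parts top to bottom), the cell in column j (1-based)
-- of a row of length r with rows `below` underneath has hook length
-- (r - j) + #{rows below of length ≥ j} + 1.

hookAt : ℕ → List ℕ → ℕ → ℕ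
hookAt r below j = (r ∸ j) + length (filter (λ k → j ≤? k) below) + 1

firstColumnHooks : List ℕ → List ℕ
firstColumnHooks []          = []
firstColumnHooks (r ∷ below) = hookAt r below 1 ∷ firstColumnHooks below

-- f(π) = ν : the unique partition whose first-column hook lengths are
-- exactly Δᶜ(π).  With Δᶜ(π) = {h₁ > h₂ > ... > h_ℓ}, this is
-- ν_i = h_i - (ℓ - i).

insertDesc : ℕ → List ℕ → List ℕ
insertDesc x []       = x ∷ []
insertDesc x (y ∷ ys) = if does (y ≤? x) then x ∷ y ∷ ys else y ∷ insertDesc x ys

sortDesc : List ℕ → List ℕ
sortDesc []       = []
sortDesc (x ∷ xs) = insertDesc x (sortDesc xs)

partitionFromFirstColumnHooks : List ℕ → List ℕ
partitionFromFirstColumnHooks []       = []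
partitionFromFirstColumnHooks (h ∷ hs) = (h ∸ length hs) ∷ partitionFromFirstColumnHooks hs

f : ℕ → ℕ → List ℕ → List ℕ
f a b π = partitionFromFirstColumnHooks (sortDesc (Δᶜ a b π))

-- Levels of the unit squares immediately east of the north steps:
-- a north step from (x , y) has the square [x,x+1]×[y,y+1] to its east,
-- whose southeast corner (x+1 , y) has level b*y - a*(x+1).

eastLevelsFrom : ℕ → ℕ → ℕ → ℕ → Word → List ℤ
eastLevelsFrom a b x y []      = []
eastLevelsFrom a b x y (N ∷ u) =
  (+ (b * y) ℤ.- + (a * suc x)) ∷ eastLevelsFrom a b x (suc y) u
eastLevelsFrom a b x y (E ∷ u) = eastLevelsFrom a b (suc x) y u

eastLevels : ℕ → ℕ → List ℕ → List ℤ
eastLevels a b π = eastLevelsFrom a b 0 0 (word a b π)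

zetaRows : ℕ → List ℤ → List ℕ → List ℕ
zetaRows b L []          = []
zetaRows b L (r ∷ below) =
  if does (any? (λ l → + hookAt r below 1 ℤ.≟ l) L)
  then length (filter (λ j → hookAt r below j ≤? b) (map suc (upTo r)))
       ∷ zetaRows b L below
  else zetaRows b L below

ζ : ℕ → ℕ → List ℕ → List ℕ
ζ a b π = zetaRows b (eastLevels a b π) (f a b π)

-- Let u = word(π).  Both sides are words with a letters N and b letters E, and such a word
-- is determined by its "east counts": for each N, the number of E's before it (Paths).
--  * sw⁺ side (SwSide).  Walking rev u from the end point of u, the letter for the step of u
--    starting at level l is met at level −l (Levels).  Since gcd(a,b) = 1, steps of u start at
--    distinct levels (Lattice, Geometry), so sw⁺(rev u) lists the steps of u by increasing
--    start level, and its N for a north step at level k is preceded by eastsBelow k letters E.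
--  * ζ side (Hooks, ZetaSide).  The hooks of ν = f(π) in a row with first-column hook h are
--    h − g for the g < h outside Δᶜ(π); so a kept row has windowGaps h cells, the number of
--    gaps of Δᶜ in [h − b, h) (Windows).  The row with hook h is kept iff a north step starts
--    at level a + h.
--  * Key identity (KeyIdentity): windowGaps h = eastsBelow (h + a).  Both sides vanish at h = 0
--    and equal b for large h, and a local analysis of the squares at levels m and m − b shows
--    that eastsBelow (· + a) never grows faster than windowGaps.
-- Reading the rows of ζ(π) bottom to top therefore gives exactly the east counts of
-- sw⁺(rev u) (ZetaSide.padded-ζrows, SwSide.swPlus-word), which is the theorem.
module Submission where

open import Defs
open import Data.Nat using (ℕ; _<_)
open import Data.Nat.GCD using (gcd)
open import Data.List using (List)
open import Relation.Binary.PropositionalEquality using (_≡_; cong; sym; module ≡-Reasoning)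

module Counting where

  open import Data.Nat
  open import Data.Nat.Properties
  open import Data.List using (List; []; _∷_; _++_; length; replicate; reverse; map; filter; concatMap; upTo; _∷ʳ_)
  open import Data.List.Properties
  open import Data.List.Relation.Unary.All as All using (All; []; _∷_)
  open import Data.List.Relation.Unary.AllPairs using (AllPairs; []; _∷_)
  open import Data.List.Membership.Propositional using (_∈_)
  open import Data.List.Relation.Unary.Any using (here; there)
  open import Data.Sum using (_⊎_; inj₁; inj₂)
  open import Data.Empty using (⊥; ⊥-elim)
  open import Function using (_∘_; _⇔_; Equivalence)
  open import Relation.Nullary using (Dec; yes; no; ¬_; _×-dec_)
  open import Relation.Binary.PropositionalEquality
  open import Algebra.Properties.CommutativeSemigroup +-commutativeSemigroup
    using () renaming (interchange to +-interchange)

  χ : ∀ {P : Set} → Dec P → ℕ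
  χ (yes _) = 1
  χ (no _)  = 0

  χ-cong : ∀ {P Q : Set} → P ⇔ Q → (d : Dec P) (e : Dec Q) → χ d ≡ χ e
  χ-cong P⇔Q (yes p) (yes q) = refl
  χ-cong P⇔Q (yes p) (no ¬q) = ⊥-elim (¬q (Equivalence.to P⇔Q p))
  χ-cong P⇔Q (no ¬p) (yes q) = ⊥-elim (¬p (Equivalence.from P⇔Q q))
  χ-cong P⇔Q (no ¬p) (no ¬q) = refl

  χ-false : ∀ {P : Set} (d : Dec P) → ¬ P → χ d ≡ 0
  χ-false (yes p) ¬p = ⊥-elim (¬p p)
  χ-false (no _)  _  = refl

  χ-true : ∀ {P : Set} (d : Dec P) → P → χ d ≡ 1
  χ-true (yes _) _ = refl
  χ-true (no ¬p) p = ⊥-elim (¬p p)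

  χ-split : ∀ {A P Q R : Set} (dA : Dec A) (dP : Dec P) (dQ : Dec Q) (dR : Dec R) →
    P ⇔ (Q ⊎ R) → (Q → R → ⊥) →
    χ (dA ×-dec dP) ≡ χ (dA ×-dec dQ) + χ (dA ×-dec dR)
  χ-split (no _)  dP      dQ      dR      P⇔Q⊎R disj = refl
  χ-split (yes _) (yes p) (yes q) (yes r) P⇔Q⊎R disj = ⊥-elim (disj q r)
  χ-split (yes _) (yes p) (yes q) (no _)  P⇔Q⊎R disj = refl
  χ-split (yes _) (yes p) (no _)  (yes r) P⇔Q⊎R disj = refl
  χ-split (yes _) (yes p) (no ¬q) (no ¬r) P⇔Q⊎R disj with Equivalence.to P⇔Q⊎R p
  ... | inj₁ q = ⊥-elim (¬q q)
  ... | inj₂ r = ⊥-elim (¬r r)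
  χ-split (yes _) (no ¬p) (yes q) dR      P⇔Q⊎R disj = ⊥-elim (¬p (Equivalence.from P⇔Q⊎R (inj₁ q)))
  χ-split (yes _) (no ¬p) (no _)  (yes r) P⇔Q⊎R disj = ⊥-elim (¬p (Equivalence.from P⇔Q⊎R (inj₂ r)))
  χ-split (yes _) (no ¬p) (no _)  (no _)  P⇔Q⊎R disj = refl

  sumBelow : (ℕ → ℕ) → ℕ → ℕ
  sumBelow f zero    = 0
  sumBelow f (suc n) = sumBelow f n + f n

  sumBelow-cong : ∀ {f g : ℕ → ℕ} n → (∀ k → k < n → f k ≡ g k) → sumBelow f n ≡ sumBelow g n
  sumBelow-cong zero    f≡g = refl
  sumBelow-cong (suc n) f≡g =
    cong₂ _+_ (sumBelow-cong n (λ k k<n → f≡g k (m<n⇒m<1+n k<n))) (f≡g n ≤-refl)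

  sumBelow-+ : ∀ f g n → sumBelow (λ k → f k + g k) n ≡ sumBelow f n + sumBelow g n
  sumBelow-+ f g zero    = refl
  sumBelow-+ f g (suc n) rewrite sumBelow-+ f g n = +-interchange (sumBelow f n) (sumBelow g n) (f n) (g n)

  sumBelow-split : ∀ f m n → sumBelow f (m + n) ≡ sumBelow f m + sumBelow (λ k → f (m + k)) n
  sumBelow-split f m zero    rewrite +-identityʳ m = sym (+-identityʳ _)
  sumBelow-split f m (suc n) rewrite +-suc m n | sumBelow-split f m n = +-assoc (sumBelow f m) _ _

  sumBelow-const : ∀ c n → sumBelow (λ _ → c) n ≡ n * c
  sumBelow-const c zero    = refl
  sumBelow-const c (suc n) rewrite sumBelow-const c n = +-comm (n * c) c

  sumBelow-point : ∀ {P : Set} (d : Dec P) l n →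
    sumBelow (λ k → χ (d ×-dec (l ≟ k))) n ≡ χ (d ×-dec (l <? n))
  sumBelow-point d l zero with d
  ... | yes _ = refl
  ... | no _  = refl
  sumBelow-point d l (suc n) rewrite sumBelow-point d l n with d
  ... | no _  = refl
  ... | yes p with l <? n | l ≟ n | l <? suc n
  ...   | yes l<n | yes refl | _         = ⊥-elim (<-irrefl refl l<n)
  ...   | yes l<n | no _     | yes _     = refl
  ...   | yes l<n | no _     | no l≮1+n = ⊥-elim (l≮1+n (m<n⇒m<1+n l<n))
  ...   | no _    | yes refl | yes _     = refl
  ...   | no _    | yes refl | no l≮1+n = ⊥-elim (l≮1+n ≤-refl)
  ...   | no l≮n  | no l≢n   | yes l<1+n = ⊥-elim (l≮n (≤∧≢⇒< (≤-pred l<1+n) l≢n))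
  ...   | no _    | no _     | no _      = refl

  sumBy : ∀ {A : Set} → (A → ℕ) → List A → ℕ
  sumBy f []       = 0
  sumBy f (x ∷ xs) = f x + sumBy f xs

  count : ∀ {A : Set} {P : A → Set} → (∀ x → Dec (P x)) → List A → ℕ
  count P? = sumBy (λ x → χ (P? x))

  sumBy-cong : ∀ {A : Set} {f g : A → ℕ} {xs} → All (λ x → f x ≡ g x) xs → sumBy f xs ≡ sumBy g xs
  sumBy-cong []         = refl
  sumBy-cong (e ∷ es) = cong₂ _+_ e (sumBy-cong es)

  sumBy-zero : ∀ {A : Set} {f : A → ℕ} {xs} → All (λ x → f x ≡ 0) xs → sumBy f xs ≡ 0
  sumBy-zero []              = refl
  sumBy-zero (e ∷ es) rewrite e = sumBy-zero es

  sumBy-+ : ∀ {A : Set} (f g : A → ℕ) xs → sumBy (λ x → f x + g x) xs ≡ sumBy f xs + sumBy g xs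
  sumBy-+ f g []       = refl
  sumBy-+ f g (x ∷ xs) rewrite sumBy-+ f g xs = +-interchange (f x) (g x) (sumBy f xs) (sumBy g xs)

  sumBy-++ : ∀ {A : Set} (f : A → ℕ) xs ys → sumBy f (xs ++ ys) ≡ sumBy f xs + sumBy f ys
  sumBy-++ f []       ys = refl
  sumBy-++ f (x ∷ xs) ys rewrite sumBy-++ f xs ys = sym (+-assoc (f x) _ _)

  sumBy-map : ∀ {A B : Set} (f : B → ℕ) (g : A → B) xs → sumBy f (map g xs) ≡ sumBy (f ∘ g) xs
  sumBy-map f g []       = refl
  sumBy-map f g (x ∷ xs) = cong (f (g x) +_) (sumBy-map f g xs)

  sumBy-reverse : ∀ {A : Set} (f : A → ℕ) xs → sumBy f (reverse xs) ≡ sumBy f xs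
  sumBy-reverse f []       = refl
  sumBy-reverse f (x ∷ xs) = begin
    sumBy f (reverse (x ∷ xs))         ≡⟨ cong (sumBy f) (unfold-reverse x xs) ⟩
    sumBy f (reverse xs ++ x ∷ [])     ≡⟨ sumBy-++ f (reverse xs) (x ∷ []) ⟩
    sumBy f (reverse xs) + (f x + 0)   ≡⟨ cong₂ _+_ (sumBy-reverse f xs) (+-identityʳ (f x)) ⟩
    sumBy f xs + f x                   ≡⟨ +-comm (sumBy f xs) (f x) ⟩
    sumBy f (x ∷ xs)                   ∎
    where open ≡-Reasoning

  sumBy-upTo : ∀ f n → sumBy f (upTo n) ≡ sumBelow f n
  sumBy-upTo f zero    = refl
  sumBy-upTo f (suc n) = begin
    sumBy f (upTo (suc n))         ≡⟨ cong (sumBy f) (sym (upTo-∷ʳ n)) ⟩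
    sumBy f (upTo n ++ n ∷ [])     ≡⟨ sumBy-++ f (upTo n) (n ∷ []) ⟩
    sumBy f (upTo n) + (f n + 0)   ≡⟨ cong₂ _+_ (sumBy-upTo f n) (+-identityʳ (f n)) ⟩
    sumBelow f n + f n             ∎
    where open ≡-Reasoning

  sumBelow-sumBy : ∀ {A : Set} (f : ℕ → A → ℕ) xs n →
    sumBelow (λ k → sumBy (f k) xs) n ≡ sumBy (λ x → sumBelow (λ k → f k x) n) xs
  sumBelow-sumBy f xs zero    = sym (sumBy-zero {xs = xs} (All.tabulate (λ _ → refl)))
  sumBelow-sumBy f xs (suc n) rewrite sumBelow-sumBy f xs n =
    sym (sumBy-+ (λ x → sumBelow (λ k → f k x) n) (f n) xs)

  count-atMostOne : ∀ {A : Set} {R : A → A → Set} {P : A → Set} (P? : ∀ x → Dec (P x)) {xs} →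
    AllPairs R xs → (∀ {x y} → P x → P y → R x y → ⊥) → count P? xs ≤ 1
  count-atMostOne P? []                  excl = z≤n
  count-atMostOne P? {x ∷ xs} (Rx ∷ Rxs) excl with P? x
  ... | yes px = s≤s (≤-reflexive (sumBy-zero (All.map (λ {y} Rxy → χ-false (P? y) (λ py → excl px py Rxy)) Rx)))
  ... | no _   = count-atMostOne P? Rxs excl

  count-member : ∀ {A : Set} {P : A → Set} (P? : ∀ x → Dec (P x)) {x xs} → x ∈ xs → P x → 1 ≤ count P? xs
  count-member P? {x} (here refl) px rewrite χ-true (P? x) px = s≤s z≤n
  count-member P? {xs = y ∷ _} (there x∈xs) px = ≤-trans (count-member P? x∈xs px) (m≤n+m _ (χ (P? y)))

  length-filter-upTo : ∀ {P : ℕ → Set} (P? : ∀ x → Dec (P x)) n →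
    length (filter P? (upTo n)) ≡ sumBelow (λ k → χ (P? k)) n
  length-filter-upTo P? zero    = refl
  length-filter-upTo P? (suc n) = begin
    length (filter P? (upTo (suc n)))                          ≡⟨ cong (λ z → length (filter P? z)) (sym (upTo-∷ʳ n)) ⟩
    length (filter P? (upTo n ++ n ∷ []))                      ≡⟨ cong length (filter-++ P? (upTo n) (n ∷ [])) ⟩
    length (filter P? (upTo n) ++ filter P? (n ∷ []))          ≡⟨ length-++ (filter P? (upTo n)) ⟩
    length (filter P? (upTo n)) + length (filter P? (n ∷ []))  ≡⟨ cong₂ _+_ (length-filter-upTo P? n) (last (P? n)) ⟩
    sumBelow (λ k → χ (P? k)) n + χ (P? n)                     ∎
    where
    open ≡-Reasoning
    last : (d : Dec _) → length (filter P? (n ∷ [])) ≡ χ d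
    last (yes p) rewrite filter-accept P? {n} {[]} p = refl
    last (no ¬p) rewrite filter-reject P? {n} {[]} ¬p = refl

  concatMap-upTo-suc : ∀ {A : Set} (f : ℕ → List A) n →
    concatMap f (upTo (suc n)) ≡ concatMap f (upTo n) ++ f n
  concatMap-upTo-suc f n = begin
    concatMap f (upTo (suc n))       ≡⟨ cong (concatMap f) (sym (upTo-∷ʳ n)) ⟩
    concatMap f (upTo n ++ n ∷ [])   ≡⟨ concatMap-++ f (upTo n) (n ∷ []) ⟩
    concatMap f (upTo n) ++ (f n ++ []) ≡⟨ cong (concatMap f (upTo n) ++_) (++-identityʳ (f n)) ⟩
    concatMap f (upTo n) ++ f n      ∎
    where open ≡-Reasoning

  upTo-+ : ∀ m n → upTo (m + n) ≡ upTo m ++ map (m +_) (upTo n)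
  upTo-+ m zero    rewrite +-identityʳ m = sym (++-identityʳ (upTo m))
  upTo-+ m (suc n) = begin
    upTo (m + suc n)                           ≡⟨ cong upTo (+-suc m n) ⟩
    upTo (suc (m + n))                         ≡⟨ sym (upTo-∷ʳ (m + n)) ⟩
    upTo (m + n) ∷ʳ (m + n)                    ≡⟨ cong (_∷ʳ (m + n)) (upTo-+ m n) ⟩
    (upTo m ++ map (m +_) (upTo n)) ∷ʳ (m + n) ≡⟨ ++-assoc (upTo m) _ _ ⟩
    upTo m ++ (map (m +_) (upTo n) ∷ʳ (m + n)) ≡⟨ cong (upTo m ++_) (sym (map-++ (m +_) (upTo n) (n ∷ []))) ⟩
    upTo m ++ map (m +_) (upTo n ∷ʳ n)         ≡⟨ cong (λ z → upTo m ++ map (m +_) z) (upTo-∷ʳ n) ⟩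
    upTo m ++ map (m +_) (upTo (suc n))        ∎
    where open ≡-Reasoning

  length-concatMap-replicate : ∀ {A : Set} (n : ℕ → ℕ) (v : ℕ → A) xs →
    length (concatMap (λ k → replicate (n k) (v k)) xs) ≡ sumBy n xs
  length-concatMap-replicate n v []       = refl
  length-concatMap-replicate n v (x ∷ xs) =
    trans (length-++ (replicate (n x) (v x)))
          (cong₂ _+_ (length-replicate (n x)) (length-concatMap-replicate n v xs))

  concatMap-replicate-zero : (n v : ℕ → ℕ) (xs : List ℕ) → All (λ k → v k ≡ 0) xs →
    concatMap (λ k → replicate (n k) (v k)) xs ≡ replicate (sumBy n xs) 0
  concatMap-replicate-zero n v []       _        = refl
  concatMap-replicate-zero n v (x ∷ xs) (e ∷ es) rewrite e | concatMap-replicate-zero n v xs es =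
    sym (replicate-+ (n x) (sumBy n xs))
    where
    replicate-+ : ∀ p q → replicate (p + q) 0 ≡ replicate p 0 ++ replicate q 0
    replicate-+ zero    q = refl
    replicate-+ (suc p) q = cong (0 ∷_) (replicate-+ p q)

  concatMap-empty : ∀ {A B : Set} (f : A → List B) xs → All (λ x → f x ≡ []) xs → concatMap f xs ≡ []
  concatMap-empty f []       _        = refl
  concatMap-empty f (x ∷ xs) (e ∷ es) rewrite e = concatMap-empty f xs es

  concatMap-upTo-stable : ∀ {A : Set} (f : ℕ → List A) n m → (∀ k → n ≤ k → f k ≡ []) →
    concatMap f (upTo (n + m)) ≡ concatMap f (upTo n)
  concatMap-upTo-stable f n m empty = begin
    concatMap f (upTo (n + m))                                     ≡⟨ cong (concatMap f) (upTo-+ n m) ⟩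
    concatMap f (upTo n ++ map (n +_) (upTo m))                    ≡⟨ concatMap-++ f (upTo n) _ ⟩
    concatMap f (upTo n) ++ concatMap f (map (n +_) (upTo m))      ≡⟨ cong (concatMap f (upTo n) ++_) (concatMap-map f (n +_) (upTo m)) ⟩
    concatMap f (upTo n) ++ concatMap (f ∘ (n +_)) (upTo m)        ≡⟨ cong (concatMap f (upTo n) ++_) tail-empty ⟩
    concatMap f (upTo n) ++ []                                     ≡⟨ ++-identityʳ _ ⟩
    concatMap f (upTo n)                                           ∎
    where
    open ≡-Reasoning
    tail-empty : concatMap (f ∘ (n +_)) (upTo m) ≡ []
    tail-empty = concatMap-empty (f ∘ (n +_)) (upTo m) (All.tabulate (λ {k} _ → empty (n + k) (m≤m+n n k)))

module Windows where

  open Counting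
  open import Data.Nat
  open import Data.Nat.Properties
  open import Data.Product using (_×_; _,_; proj₁)
  open import Data.Sum using (_⊎_; inj₁; inj₂; [_,_])
  open import Function using (mk⇔)
  open import Relation.Nullary using (Dec; yes; no; ¬_; ¬?; _×-dec_)
  open import Relation.Binary.PropositionalEquality hiding ([_])
  open import Algebra.Properties.CommutativeSemigroup +-commutativeSemigroup
    using () renaming (xy∙z≈xz∙y to +-right-comm)

  module _ {S : ℕ → Set} (S? : ∀ g → Dec (S g)) (b : ℕ) where

    windowGaps : ℕ → ℕ
    windowGaps h = sumBelow (λ g → χ (¬? (S? g) ×-dec (h ≤? g + b))) h

    gap gapLeaving : ℕ → ℕ
    gap        m = χ (¬? (S? m))
    gapLeaving m = χ ((b ≤? m) ×-dec ¬? (S? (m ∸ b)))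

    -- Among the g < m, only g = m − b has g + b = m, and it counts iff it is a gap.
    gapLeaving-sum : 0 < b → ∀ m → sumBelow (λ g → χ (¬? (S? g) ×-dec (g + b ≟ m))) m ≡ gapLeaving m
    gapLeaving-sum b>0 m = begin
      sumBelow (λ g → χ (¬? (S? g) ×-dec (g + b ≟ m))) m
        ≡⟨ sumBelow-cong m (λ g _ → χ-cong (mk⇔ to from) _ _) ⟩
      sumBelow (λ g → χ (((b ≤? m) ×-dec ¬? (S? (m ∸ b))) ×-dec (m ∸ b ≟ g))) m
        ≡⟨ sumBelow-point ((b ≤? m) ×-dec ¬? (S? (m ∸ b))) (m ∸ b) m ⟩
      χ (((b ≤? m) ×-dec ¬? (S? (m ∸ b))) ×-dec (m ∸ b <? m))
        ≡⟨ χ-cong (mk⇔ proj₁ (λ c → c , ∸-monoʳ-< b>0 (proj₁ c))) _ _ ⟩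
      gapLeaving m ∎
      where
      open ≡-Reasoning
      to : ∀ {g} → ¬ S g × g + b ≡ m → ((b ≤ m) × ¬ S (m ∸ b)) × m ∸ b ≡ g
      to {g} (¬Sg , refl) = (m≤n+m b g , subst (λ z → ¬ S z) (sym (m+n∸n≡m g b)) ¬Sg) , m+n∸n≡m g b
      from : ∀ {g} → ((b ≤ m) × ¬ S (m ∸ b)) × m ∸ b ≡ g → ¬ S g × g + b ≡ m
      from ((b≤m , ¬S) , refl) = ¬S , m∸n+n≡m b≤m

    -- Sliding the window from [m − b, m) to [m + 1 − b, m + 1): the gap m enters,
    -- the gap m − b (if any) leaves.
    windowGaps-step : 0 < b → ∀ m → windowGaps (suc m) + gapLeaving m ≡ windowGaps m + gap m
    windowGaps-step b>0 m = begin
      windowGaps (suc m) + gapLeaving m               ≡⟨ cong (λ z → sumBelow stays m + z + gapLeaving m) entering ⟩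
      sumBelow stays m + gap m + gapLeaving m         ≡⟨ +-right-comm (sumBelow stays m) (gap m) (gapLeaving m) ⟩
      sumBelow stays m + gapLeaving m + gap m         ≡⟨ cong (λ z → sumBelow stays m + z + gap m) (sym (gapLeaving-sum b>0 m)) ⟩
      sumBelow stays m + sumBelow leaves m + gap m    ≡⟨ cong (_+ gap m) (sym (sumBelow-+ stays leaves m)) ⟩
      sumBelow (λ g → stays g + leaves g) m + gap m   ≡⟨ cong (_+ gap m) (sym (sumBelow-cong m (λ g _ → split g))) ⟩
      windowGaps m + gap m                            ∎
      where
      open ≡-Reasoning
      stays leaves : ℕ → ℕ
      stays  g = χ (¬? (S? g) ×-dec (suc m ≤? g + b))
      leaves g = χ (¬? (S? g) ×-dec (g + b ≟ m))
      entering : χ (¬? (S? m) ×-dec (suc m ≤? m + b)) ≡ gap m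
      entering = χ-cong (mk⇔ proj₁ (λ ¬Sm → ¬Sm , subst (_≤ m + b) (+-comm m 1) (+-monoʳ-≤ m b>0))) _ _
      split : ∀ g → χ (¬? (S? g) ×-dec (m ≤? g + b)) ≡ stays g + leaves g
      split g = χ-split (¬? (S? g)) (m ≤? g + b) (suc m ≤? g + b) (g + b ≟ m)
        (mk⇔ cases [ <⇒≤ , (λ g+b≡m → ≤-reflexive (sym g+b≡m)) ]) (λ lt eq → <-irrefl (sym eq) lt)
        where
        cases : m ≤ g + b → suc m ≤ g + b ⊎ g + b ≡ m
        cases m≤ with m ≟ g + b
        ... | yes m≡ = inj₂ (sym m≡)
        ... | no m≢  = inj₁ (≤∧≢⇒< m≤ m≢)

    windowGaps-beyond : ∀ n → (∀ {g} → S g → g < n) → windowGaps (n + b) ≡ b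
    windowGaps-beyond n S<n = begin
      windowGaps (n + b)                                        ≡⟨ sumBelow-cong (n + b) (λ g _ → χ-cong (mk⇔ to from) _ (n ≤? g)) ⟩
      sumBelow beyond (n + b)                                   ≡⟨ sumBelow-split beyond n b ⟩
      sumBelow beyond n + sumBelow (λ t → beyond (n + t)) b    ≡⟨ cong₂ _+_ before after ⟩
      0 + b                                                     ∎
      where
      open ≡-Reasoning
      beyond : ℕ → ℕ
      beyond g = χ (n ≤? g)
      to : ∀ {g} → ¬ S g × n + b ≤ g + b → n ≤ g
      to {g} (_ , le) = +-cancelʳ-≤ b n g le
      from : ∀ {g} → n ≤ g → ¬ S g × n + b ≤ g + b
      from n≤g = (λ Sg → <-irrefl refl (<-≤-trans (S<n Sg) n≤g)) , +-monoˡ-≤ b n≤g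
      before : sumBelow beyond n ≡ 0
      before = trans (sumBelow-cong n (λ g g<n → χ-false (n ≤? g) (<⇒≱ g<n))) (trans (sumBelow-const 0 n) (*-zeroʳ n))
      after : sumBelow (λ t → beyond (n + t)) b ≡ b
      after = trans (sumBelow-cong b (λ t _ → χ-true (n ≤? n + t) (m≤m+n n t))) (trans (sumBelow-const 1 b) (*-identityʳ b))

module Sorting where

  open import Defs using (insertDesc; sortDesc)
  open Counting using (χ)
  open import Data.Nat
  open import Data.Nat.Properties
  open import Data.Bool using (if_then_else_)
  open import Data.List using (List; []; _∷_; _++_; replicate; reverse; map; filter; concatMap; upTo)
  open import Data.List.Properties
  open import Data.List.Relation.Unary.All as All using (All; []; _∷_)
  open import Data.List.Relation.Unary.AllPairs using (AllPairs; []; _∷_)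
  import Data.List.Relation.Unary.AllPairs.Properties as AllPairs
  import Data.List.Relation.Unary.Any.Properties as Any
  open import Data.List.Relation.Unary.Linked.Properties using (Linked⇒AllPairs; applyUpTo⁺₂)
  open import Data.List.Membership.Propositional using (_∈_)
  open import Data.List.Membership.Propositional.Properties using (∈-filter⁺; ∈-filter⁻; ∈-upTo⁺; ∈-upTo⁻)
  open import Data.List.Relation.Unary.Any using (here; there)
  open import Data.Product using (_×_; _,_)
  open import Data.Sum using (_⊎_; inj₁; inj₂; [_,_])
  open import Data.Empty using (⊥-elim)
  open import Function using (_⇔_; mk⇔; Equivalence)
  open import Relation.Nullary using (Dec; yes; no; ¬_)
  open import Relation.Nullary.Decidable using (dec-true; dec-false)
  open import Relation.Binary.PropositionalEquality hiding ([_])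

  Ascending Descending : List ℕ → Set
  Ascending  = AllPairs _<_
  Descending = AllPairs (λ x y → y < x)

  All-reverse : ∀ {A : Set} {P : A → Set} {xs} → All P xs → All P (reverse xs)
  All-reverse Pxs = All.tabulate (λ x∈ → All.lookup Pxs (Any.reverse⁻ x∈))

  AllPairs-reverse : ∀ {A : Set} {R : A → A → Set} {xs} → AllPairs R xs → AllPairs (λ x y → R y x) (reverse xs)
  AllPairs-reverse {xs = []}     []           = []
  AllPairs-reverse {R = R} {xs = x ∷ xs} (Rx ∷ Rxs) =
    subst (AllPairs (λ x y → R y x)) (sym (unfold-reverse x xs))
      (AllPairs.++⁺ (AllPairs-reverse Rxs) ([] ∷ []) (All.map (λ r → r ∷ []) (All-reverse Rx)))

  reverse-replicate : ∀ {A : Set} n (x : A) → reverse (replicate n x) ≡ replicate n x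
  reverse-replicate zero    x = refl
  reverse-replicate (suc n) x = begin
    reverse (x ∷ replicate n x)        ≡⟨ unfold-reverse x (replicate n x) ⟩
    reverse (replicate n x) ++ x ∷ []  ≡⟨ cong (_++ x ∷ []) (reverse-replicate n x) ⟩
    replicate n x ++ x ∷ []            ≡⟨ snoc n ⟩
    x ∷ replicate n x                  ∎
    where
    open ≡-Reasoning
    snoc : ∀ n → replicate n x ++ x ∷ [] ≡ x ∷ replicate n x
    snoc zero    = refl
    snoc (suc n) = cong (x ∷_) (snoc n)

  filter-reverse : ∀ {A : Set} {Q : A → Set} (Q? : ∀ x → Dec (Q x)) xs →
    filter Q? (reverse xs) ≡ reverse (filter Q? xs)
  filter-reverse Q? []       = refl
  filter-reverse Q? (x ∷ xs) = begin
    filter Q? (reverse (x ∷ xs))                  ≡⟨ cong (filter Q?) (unfold-reverse x xs) ⟩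
    filter Q? (reverse xs ++ x ∷ [])              ≡⟨ filter-++ Q? (reverse xs) (x ∷ []) ⟩
    filter Q? (reverse xs) ++ filter Q? (x ∷ [])  ≡⟨ cong (_++ filter Q? (x ∷ [])) (filter-reverse Q? xs) ⟩
    reverse (filter Q? xs) ++ filter Q? (x ∷ [])  ≡⟨ last (Q? x) ⟩
    reverse (filter Q? (x ∷ xs))                  ∎
    where
    open ≡-Reasoning
    last : Dec _ → reverse (filter Q? xs) ++ filter Q? (x ∷ []) ≡ reverse (filter Q? (x ∷ xs))
    last (yes q) rewrite filter-accept Q? {x} {[]} q | filter-accept Q? {x} {xs} q = sym (unfold-reverse x (filter Q? xs))
    last (no ¬q) rewrite filter-reject Q? {x} {[]} ¬q | filter-reject Q? {x} {xs} ¬q = ++-identityʳ _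

  ascending-unique : ∀ xs ys → Ascending xs → Ascending ys → (∀ z → z ∈ xs ⇔ z ∈ ys) → xs ≡ ys
  ascending-unique []       []       _ _ same = refl
  ascending-unique []       (y ∷ ys) _ _ same with Equivalence.from (same y) (here refl)
  ... | ()
  ascending-unique (x ∷ xs) []       _ _ same with Equivalence.to (same x) (here refl)
  ... | ()
  ascending-unique (x ∷ xs) (y ∷ ys) (x< ∷ asc) (y< ∷ asc′) same =
    cong₂ _∷_ x≡y (ascending-unique xs ys asc asc′ same-tail)
    where
    head-least : ∀ {v w ws} → All (w <_) ws → v ∈ w ∷ ws → w ≤ v
    head-least w< (here refl) = ≤-refl
    head-least w< (there v∈) = <⇒≤ (All.lookup w< v∈)
    x≡y : x ≡ y
    x≡y = ≤-antisym (head-least x< (Equivalence.from (same y) (here refl)))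
                    (head-least y< (Equivalence.to (same x) (here refl)))
    drop-head : ∀ {w ws z} → w < z → z ∈ w ∷ ws → z ∈ ws
    drop-head w<z (here refl) = ⊥-elim (<-irrefl refl w<z)
    drop-head w<z (there z∈) = z∈
    same-tail : ∀ z → z ∈ xs ⇔ z ∈ ys
    same-tail z = mk⇔
      (λ z∈ → drop-head (subst (_< z) x≡y (All.lookup x< z∈)) (Equivalence.to (same z) (there z∈)))
      (λ z∈ → drop-head (subst (_< z) (sym x≡y) (All.lookup y< z∈)) (Equivalence.from (same z) (there z∈)))

  upTo-ascending : ∀ n → Ascending (upTo n)
  upTo-ascending n = Linked⇒AllPairs <-trans (applyUpTo⁺₂ (λ i → i) n (λ i → ≤-refl))

  filter-upTo-unique : ∀ {Q : ℕ → Set} (Q? : ∀ x → Dec (Q x)) K ys → Ascending ys → All (_< K) ys →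
    (∀ x → x < K → Q x ⇔ x ∈ ys) → filter Q? (upTo K) ≡ ys
  filter-upTo-unique Q? K ys asc ys<K char =
    ascending-unique _ _ (AllPairs.filter⁺ Q? (upTo-ascending K)) asc λ z → mk⇔
      (λ z∈ → let (z∈upTo , qz) = ∈-filter⁻ Q? {xs = upTo K} z∈
              in Equivalence.to (char z (∈-upTo⁻ z∈upTo)) qz)
      (λ z∈ → ∈-filter⁺ Q? (∈-upTo⁺ (All.lookup ys<K z∈)) (Equivalence.from (char z (All.lookup ys<K z∈)) z∈))

  map-filter : ∀ {A B : Set} {Q : A → Set} (Q? : ∀ x → Dec (Q x)) (f : A → B) xs →
    map f (filter Q? xs) ≡ concatMap (λ x → replicate (χ (Q? x)) (f x)) xs
  map-filter Q? f []       = refl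
  map-filter Q? f (x ∷ xs) with Q? x
  ... | yes _ = cong (f x ∷_) (map-filter Q? f xs)
  ... | no _  = map-filter Q? f xs

  insertDesc-step : ∀ x y ys →
    (y ≤ x × insertDesc x (y ∷ ys) ≡ x ∷ y ∷ ys) ⊎ (¬ y ≤ x × insertDesc x (y ∷ ys) ≡ y ∷ insertDesc x ys)
  insertDesc-step x y ys with y ≤? x
  ... | yes y≤x = inj₁ (y≤x , cong (λ c → if c then x ∷ y ∷ ys else y ∷ insertDesc x ys) (dec-true (y ≤? x) y≤x))
  ... | no y≰x = inj₂ (y≰x , cong (λ c → if c then x ∷ y ∷ ys else y ∷ insertDesc x ys) (dec-false (y ≤? x) y≰x))

  insertDesc-∈ : ∀ x ys z → z ∈ insertDesc x ys ⇔ (z ≡ x ⊎ z ∈ ys)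
  insertDesc-∈ x []       z = mk⇔ (λ { (here refl) → inj₁ refl }) (λ { (inj₁ refl) → here refl })
  insertDesc-∈ x (y ∷ ys) z with insertDesc-step x y ys
  ... | inj₁ (_ , eq) rewrite eq = mk⇔
    (λ { (here refl) → inj₁ refl ; (there z∈) → inj₂ z∈ })
    (λ { (inj₁ refl) → here refl ; (inj₂ z∈) → there z∈ })
  ... | inj₂ (_ , eq) rewrite eq = mk⇔
    (λ { (here refl) → inj₂ (here refl)
       ; (there z∈) → [ inj₁ , (λ z∈ys → inj₂ (there z∈ys)) ] (Equivalence.to (insertDesc-∈ x ys z) z∈) })
    (λ { (inj₁ refl) → there (Equivalence.from (insertDesc-∈ x ys z) (inj₁ refl))
       ; (inj₂ (here refl)) → here refl
       ; (inj₂ (there z∈)) → there (Equivalence.from (insertDesc-∈ x ys z) (inj₂ z∈)) })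

  insertDesc-descending : ∀ x ys → Descending ys → ¬ (x ∈ ys) → Descending (insertDesc x ys)
  insertDesc-descending x []       desc x∉ = [] ∷ []
  insertDesc-descending x (y ∷ ys) (y> ∷ desc) x∉ with insertDesc-step x y ys
  ... | inj₁ (y≤x , eq) rewrite eq =
    (≤∧≢⇒< y≤x (λ y≡x → x∉ (here (sym y≡x))) ∷ All.map (λ v<y → <-≤-trans v<y y≤x) y>) ∷ y> ∷ desc
  ... | inj₂ (y≰x , eq) rewrite eq =
    All.tabulate (λ {z} z∈ → [ (λ z≡x → subst (_< y) (sym z≡x) (≰⇒> y≰x)) , All.lookup y> ]
                               (Equivalence.to (insertDesc-∈ x ys z) z∈))
    ∷ insertDesc-descending x ys desc (λ x∈ → x∉ (there x∈))

  sortDesc-∈ : ∀ xs z → z ∈ sortDesc xs ⇔ z ∈ xs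
  sortDesc-∈ []       z = mk⇔ (λ ()) (λ ())
  sortDesc-∈ (x ∷ xs) z = mk⇔
    (λ z∈ → [ (λ z≡x → here z≡x) , (λ z∈′ → there (Equivalence.to (sortDesc-∈ xs z) z∈′)) ]
              (Equivalence.to (insertDesc-∈ x (sortDesc xs) z) z∈))
    (λ { (here z≡x) → Equivalence.from (insertDesc-∈ x (sortDesc xs) z) (inj₁ z≡x)
       ; (there z∈) → Equivalence.from (insertDesc-∈ x (sortDesc xs) z) (inj₂ (Equivalence.from (sortDesc-∈ xs z) z∈)) })

  sortDesc-descending : ∀ xs → AllPairs (λ x y → ¬ x ≡ y) xs → Descending (sortDesc xs)
  sortDesc-descending []       _          = []
  sortDesc-descending (x ∷ xs) (x≢ ∷ distinct) =
    insertDesc-descending x (sortDesc xs) (sortDesc-descending xs distinct)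
      (λ x∈ → All.lookup x≢ (Equivalence.to (sortDesc-∈ xs x) x∈) refl)

module Hooks where

  open import Defs using (hookAt; partitionFromFirstColumnHooks; zetaRows)
  open Counting
  open Windows using (windowGaps)
  open Sorting using (Descending)
  open import Data.Nat
  open import Data.Nat.Properties
  open import Data.Integer as ℤ using (ℤ; +_)
  open import Data.List using (List; []; _∷_; _++_; length; map; filter; upTo; applyUpTo; _∷ʳ_)
  open import Data.List.Properties
  open import Data.List.Relation.Unary.All as All using (All; []; _∷_)
  import Data.List.Relation.Unary.All.Properties as All
  open import Data.List.Relation.Unary.AllPairs using ([]; _∷_)
  open import Data.List.Membership.DecPropositional _≟_ using (_∈?_; _∈_)
  open import Data.List.Relation.Unary.Any using (Any; here; there; any?)
  open import Data.Product using (_×_; _,_; proj₁)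
  open import Data.Empty using (⊥-elim)
  open import Function using (_∘_; _⇔_; mk⇔; Equivalence)
  open import Relation.Nullary using (Dec; yes; no; ¬_; ¬?; _×-dec_)
  open import Relation.Binary.PropositionalEquality

  ν : List ℕ → List ℕ
  ν = partitionFromFirstColumnHooks

  rowHooks : ℕ → List ℕ → List ℕ
  rowHooks r below = map (hookAt r below) (map suc (upTo r))

  _∉?_ : ∀ g (X : List ℕ) → Dec (¬ (g ∈ X))
  g ∉? X = ¬? (g ∈? X)

  length-descending : ∀ h X → Descending X → All (_< h) X → length X ≤ h
  length-descending h []      _            _          = z≤n
  length-descending h (x ∷ X) (x> ∷ desc) (x<h ∷ _) = ≤-trans (s≤s (length-descending x X desc x>)) x<h

  ν-rows-bounded : ∀ h X → Descending X → All (_< h) X → All (_≤ h ∸ length X) (ν X)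
  ν-rows-bounded h []      _            _          = []
  ν-rows-bounded h (x ∷ X) (x> ∷ desc) (x<h ∷ _) =
    top ∷ All.map (λ v≤ → ≤-trans v≤ top) (ν-rows-bounded x X desc x>)
    where
    top : x ∸ length X ≤ h ∸ suc (length X)
    top = ∸-monoˡ-≤ (suc (length X)) x<h

  hookAt-longer : ∀ r below j → j ≤ r → hookAt (suc r) below j ≡ suc (hookAt r below j)
  hookAt-longer r below j j≤r rewrite +-∸-assoc 1 j≤r = refl

  hookAt-new-cell : ∀ r below → All (_≤ r) below → hookAt (suc r) below (suc r) ≡ 1
  hookAt-new-cell r below below≤r
    rewrite n∸n≡0 r | filter-none (λ k → suc r ≤? k) {below} (All.map (λ v≤r → <⇒≱ (s≤s v≤r)) below≤r) = refl

  hookAt-row-below : ∀ r below j → j ≤ r → hookAt r (r ∷ below) j ≡ suc (hookAt r below j)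
  hookAt-row-below r below j j≤r rewrite filter-accept (λ k → j ≤? k) {r} {below} j≤r =
    cong (_+ 1) (+-suc (r ∸ j) _)

  upTo-below : ∀ n → All (_< n) (upTo n)
  upTo-below n = All.applyUpTo⁺₁ (λ i → i) n (λ i<n → i<n)

  filter-cong-local : ∀ {A : Set} {P Q : A → Set} (P? : ∀ x → Dec (P x)) (Q? : ∀ x → Dec (Q x)) {xs} →
    All (λ x → P x ⇔ Q x) xs → filter P? xs ≡ filter Q? xs
  filter-cong-local P? Q? [] = refl
  filter-cong-local P? Q? {x ∷ xs} (P⇔Q ∷ agree) with P? x | Q? x
  ... | yes p | yes q = cong (x ∷_) (filter-cong-local P? Q? agree)
  ... | yes p | no ¬q = ⊥-elim (¬q (Equivalence.to P⇔Q p))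
  ... | no ¬p | yes q = ⊥-elim (¬p (Equivalence.from P⇔Q q))
  ... | no ¬p | no ¬q = filter-cong-local P? Q? agree

  -- Growing the top row by one (case h ∉ X of `firstRowHooks`).
  firstRowHooks-grow : ∀ h X → Descending X → All (_< h) X →
    rowHooks (h ∸ length X) (ν X) ≡ map (h ∸_) (filter (_∉? X) (upTo h)) →
    rowHooks (suc h ∸ length X) (ν X) ≡ map (suc h ∸_) (filter (_∉? X) (upTo (suc h)))
  firstRowHooks-grow h X desc X<h IH = begin
    rowHooks (suc h ∸ length X) (ν X)
      ≡⟨ cong (λ r → rowHooks r (ν X)) (+-∸-assoc 1 (length-descending h X desc X<h)) ⟩
    map (hookAt (suc r) (ν X)) (map suc (upTo (suc r)))
      ≡⟨ cong (map (hookAt (suc r) (ν X))) (trans (cong (map suc) (sym (upTo-∷ʳ r))) (map-++ suc (upTo r) (r ∷ []))) ⟩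
    map (hookAt (suc r) (ν X)) (map suc (upTo r) ∷ʳ suc r)
      ≡⟨ map-++ (hookAt (suc r) (ν X)) (map suc (upTo r)) (suc r ∷ []) ⟩
    map (hookAt (suc r) (ν X)) (map suc (upTo r)) ∷ʳ hookAt (suc r) (ν X) (suc r)
      ≡⟨ cong₂ _∷ʳ_ (map-cong-local (All.map (λ {j} → hookAt-longer r (ν X) j) columns≤r))
                    (hookAt-new-cell r (ν X) (ν-rows-bounded h X desc X<h)) ⟩
    map (suc ∘ hookAt r (ν X)) (map suc (upTo r)) ∷ʳ 1
      ≡⟨ cong (_∷ʳ 1) (trans (map-∘ {g = suc} {f = hookAt r (ν X)} (map suc (upTo r))) (cong (map suc) IH)) ⟩
    map suc (map (h ∸_) Z) ∷ʳ 1
      ≡⟨ cong (_∷ʳ 1) (trans (sym (map-∘ Z)) (map-cong-local (All.map (λ g<h → sym (+-∸-assoc 1 (<⇒≤ g<h))) Z<h))) ⟩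
    map (suc h ∸_) Z ∷ʳ 1
      ≡⟨ cong (map (suc h ∸_) Z ∷ʳ_) (sym (trans (+-∸-assoc 1 {h} ≤-refl) (cong suc (n∸n≡0 h)))) ⟩
    map (suc h ∸_) Z ∷ʳ (suc h ∸ h)
      ≡⟨ sym (map-++ (suc h ∸_) Z (h ∷ [])) ⟩
    map (suc h ∸_) (Z ∷ʳ h)
      ≡⟨ cong (map (suc h ∸_)) (sym Z′) ⟩
    map (suc h ∸_) (filter (_∉? X) (upTo (suc h))) ∎
    where
    open ≡-Reasoning
    r : ℕ
    r = h ∸ length X
    Z : List ℕ
    Z = filter (_∉? X) (upTo h)
    columns≤r : All (_≤ r) (map suc (upTo r))
    columns≤r = All.map⁺ (upTo-below r)
    Z<h : All (_< h) Z
    Z<h = All.filter⁺ (_∉? X) (upTo-below h)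
    h∉X : ¬ (h ∈ X)
    h∉X h∈X = <-irrefl refl (All.lookup X<h h∈X)
    Z′ : filter (_∉? X) (upTo (suc h)) ≡ Z ∷ʳ h
    Z′ = begin
      filter (_∉? X) (upTo (suc h))            ≡⟨ cong (filter (_∉? X)) (sym (upTo-∷ʳ h)) ⟩
      filter (_∉? X) (upTo h ++ h ∷ [])        ≡⟨ filter-++ (_∉? X) (upTo h) (h ∷ []) ⟩
      Z ++ filter (_∉? X) (h ∷ [])             ≡⟨ cong (Z ++_) (filter-accept (_∉? X) h∉X) ⟩
      Z ∷ʳ h                                   ∎

  -- Putting a new row of the same length underneath (case h ∈ X of `firstRowHooks`).
  firstRowHooks-stack : ∀ h X → Descending X → All (_< h) X →
    rowHooks (h ∸ length X) (ν X) ≡ map (h ∸_) (filter (_∉? X) (upTo h)) →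
    rowHooks (suc h ∸ length (h ∷ X)) (ν (h ∷ X)) ≡ map (suc h ∸_) (filter (_∉? (h ∷ X)) (upTo (suc h)))
  firstRowHooks-stack h X desc X<h IH = begin
    map (hookAt r (r ∷ ν X)) (map suc (upTo r))
      ≡⟨ map-cong-local (All.map (λ {j} → hookAt-row-below r (ν X) j) (All.map⁺ (upTo-below r))) ⟩
    map (suc ∘ hookAt r (ν X)) (map suc (upTo r))
      ≡⟨ trans (map-∘ (map suc (upTo r))) (cong (map suc) IH) ⟩
    map suc (map (h ∸_) Z)
      ≡⟨ trans (sym (map-∘ Z)) (map-cong-local (All.map (λ g<h → sym (+-∸-assoc 1 (<⇒≤ g<h))) (All.filter⁺ (_∉? X) (upTo-below h)))) ⟩
    map (suc h ∸_) Z
      ≡⟨ cong (map (suc h ∸_)) (sym Z′) ⟩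
    map (suc h ∸_) (filter (_∉? (h ∷ X)) (upTo (suc h))) ∎
    where
    open ≡-Reasoning
    r : ℕ
    r = h ∸ length X
    Z : List ℕ
    Z = filter (_∉? X) (upTo h)
    below-h : ∀ {g} → g < h → (¬ (g ∈ h ∷ X)) ⇔ (¬ (g ∈ X))
    below-h g<h = mk⇔ (λ g∉ g∈ → g∉ (there g∈))
                      (λ g∉ → λ { (here refl) → <-irrefl refl g<h ; (there g∈) → g∉ g∈ })
    Z′ : filter (_∉? (h ∷ X)) (upTo (suc h)) ≡ Z
    Z′ = begin
      filter (_∉? (h ∷ X)) (upTo (suc h))                                 ≡⟨ cong (filter (_∉? (h ∷ X))) (sym (upTo-∷ʳ h)) ⟩
      filter (_∉? (h ∷ X)) (upTo h ++ h ∷ [])                             ≡⟨ filter-++ (_∉? (h ∷ X)) (upTo h) (h ∷ []) ⟩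
      filter (_∉? (h ∷ X)) (upTo h) ++ filter (_∉? (h ∷ X)) (h ∷ [])      ≡⟨ cong (filter (_∉? (h ∷ X)) (upTo h) ++_) (filter-reject (_∉? (h ∷ X)) (λ h∉ → h∉ (here refl))) ⟩
      filter (_∉? (h ∷ X)) (upTo h) ++ []                                 ≡⟨ ++-identityʳ _ ⟩
      filter (_∉? (h ∷ X)) (upTo h)                                       ≡⟨ filter-cong-local (_∉? (h ∷ X)) (_∉? X) (All.map below-h (upTo-below h)) ⟩
      Z                                                                   ∎

  -- The classical description of hooks: if X = {h₁ > h₂ > …} are the first-column hooks
  -- of ν X, then a row of first-column hook h > max X on top of ν X has hooks
  -- exactly h − g for the g < h not in X.
  firstRowHooks : ∀ h X → Descending X → All (_< h) X →
    rowHooks (h ∸ length X) (ν X) ≡ map (h ∸_) (filter (_∉? X) (upTo h))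
  firstRowHooks zero    []      _            _              = refl
  firstRowHooks zero    (x ∷ X) _            (() ∷ _)
  firstRowHooks (suc h) []      _            _              = firstRowHooks-grow h [] [] [] (firstRowHooks h [] [] [])
  firstRowHooks (suc h) (x ∷ X) (x> ∷ desc) (x<1+h ∷ X<1+h) with x ≟ h
  ... | yes refl = firstRowHooks-stack h X desc x> (firstRowHooks h X desc x>)
  ... | no x≢h   = firstRowHooks-grow h (x ∷ X) (x> ∷ desc) X<h (firstRowHooks h (x ∷ X) (x> ∷ desc) X<h)
    where
    x<h : x < h
    x<h = ≤∧≢⇒< (≤-pred x<1+h) x≢h
    X<h : All (_< h) (x ∷ X)
    X<h = x<h ∷ All.map (λ v<x → <-trans v<x x<h) x>

  length-filter-map : ∀ {A B : Set} {P : B → Set} (P? : ∀ x → Dec (P x)) (f : A → B) xs →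
    length (filter P? (map f xs)) ≡ length (filter (P? ∘ f) xs)
  length-filter-map P? f []       = refl
  length-filter-map P? f (x ∷ xs) with P? (f x)
  ... | yes _ = cong suc (length-filter-map P? f xs)
  ... | no _  = length-filter-map P? f xs

  length-filter-filter : ∀ {A : Set} {P Q : A → Set} (P? : ∀ x → Dec (P x)) (Q? : ∀ x → Dec (Q x)) xs →
    length (filter P? (filter Q? xs)) ≡ length (filter (λ x → Q? x ×-dec P? x) xs)
  length-filter-filter P? Q? []       = refl
  length-filter-filter P? Q? (x ∷ xs) with Q? x
  ... | no _ = length-filter-filter P? Q? xs
  ... | yes _ with P? x
  ...   | yes _ = cong suc (length-filter-filter P? Q? xs)
  ...   | no _  = length-filter-filter P? Q? xs

  -- The rows of ζ, computed from ν X for a set of first-column hooks X that is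
  -- (below each of its elements) the set S, and a list L of admissible levels.
  module ZetaRows {S : ℕ → Set} (S? : ∀ g → Dec (S g)) (b : ℕ) (L : List ℤ) where

    -- A row with first-column hook h is kept when h occurs in L; it then has one cell for
    -- each gap g of S with h − b ≤ g < h (`keptRow-length`).
    kept? : ∀ h → Dec (Any (λ l → + h ≡ l) L)
    kept? h = any? (λ l → + h ℤ.≟ l) L

    AgreeBelow : ℕ → List ℕ → Set
    AgreeBelow h X = ∀ g → g < h → g ∈ X ⇔ S g

    agree-drop-head : ∀ {h′ h X} → h′ ≤ h → AgreeBelow h′ (h ∷ X) → AgreeBelow h′ X
    agree-drop-head {h′} {h} {X} h′≤h agree g g<h′ = mk⇔
      (λ g∈X → Equivalence.to (agree g g<h′) (there g∈X))
      (λ Sg → drop (Equivalence.from (agree g g<h′) Sg))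
      where
      drop : g ∈ h ∷ X → g ∈ X
      drop (here refl) = ⊥-elim (<-irrefl refl (<-≤-trans g<h′ h′≤h))
      drop (there g∈X) = g∈X

    agree-tail : ∀ {h X} → All (_< h) X → All (λ h′ → AgreeBelow h′ (h ∷ X)) X → All (λ h′ → AgreeBelow h′ X) X
    agree-tail X<h agree = All.zipWith (λ (h′<h , agree-h′) → agree-drop-head (<⇒≤ h′<h) agree-h′) (X<h , agree)

    firstColumnHook : ∀ h X → Descending X → All (_< h) X → All (0 <_) X → 0 < h →
      hookAt (h ∸ length X) (ν X) 1 ≡ h
    firstColumnHook (suc h) X desc X<h X>0 _ =
      head-of (suc h ∸ length X) (ν X)
        (trans (firstRowHooks (suc h) X desc X<h)
               (cong (map (suc h ∸_)) (filter-accept (_∉? X) {0} {applyUpTo suc h} (λ 0∈X → <-irrefl refl (All.lookup X>0 0∈X)))))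
      where
      head-of : ∀ r below {h t} → rowHooks r below ≡ h ∷ t → hookAt r below 1 ≡ h
      head-of zero    below ()
      head-of (suc r) below eq = proj₁ (∷-injective eq)

    keptRow-length : ∀ h X → Descending X → All (_< h) X → AgreeBelow h X →
      length (filter (λ j → hookAt (h ∸ length X) (ν X) j ≤? b) (map suc (upTo (h ∸ length X)))) ≡ windowGaps S? b h
    keptRow-length h X desc X<h agree = begin
      length (filter (λ j → hookAt r (ν X) j ≤? b) (map suc (upTo r)))
        ≡⟨ sym (length-filter-map (_≤? b) (hookAt r (ν X)) (map suc (upTo r))) ⟩
      length (filter (_≤? b) (rowHooks r (ν X)))
        ≡⟨ cong (λ z → length (filter (_≤? b) z)) (firstRowHooks h X desc X<h) ⟩
      length (filter (_≤? b) (map (h ∸_) (filter (_∉? X) (upTo h))))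
        ≡⟨ length-filter-map (_≤? b) (h ∸_) (filter (_∉? X) (upTo h)) ⟩
      length (filter (λ g → h ∸ g ≤? b) (filter (_∉? X) (upTo h)))
        ≡⟨ length-filter-filter _ (_∉? X) (upTo h) ⟩
      length (filter (λ g → (g ∉? X) ×-dec (h ∸ g ≤? b)) (upTo h))
        ≡⟨ length-filter-upTo _ h ⟩
      sumBelow (λ g → χ ((g ∉? X) ×-dec (h ∸ g ≤? b))) h
        ≡⟨ sumBelow-cong h (λ g g<h → χ-cong (same g g<h) _ _) ⟩
      windowGaps S? b h ∎
      where
      open ≡-Reasoning
      r : ℕ
      r = h ∸ length X
      same : ∀ g → g < h → ((¬ g ∈ X) × h ∸ g ≤ b) ⇔ ((¬ S g) × h ≤ g + b)
      same g g<h = mk⇔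
        (λ (g∉ , le) → (λ Sg → g∉ (Equivalence.from (agree g g<h) Sg)) , ≤-trans (m≤n+m∸n h g) (+-monoʳ-≤ g le))
        (λ (¬Sg , le) → (λ g∈ → ¬Sg (Equivalence.to (agree g g<h) g∈)) , m≤n+o⇒m∸n≤o h g le)

    zetaRows-ν : ∀ X → Descending X → All (0 <_) X → All (λ h → AgreeBelow h X) X →
      zetaRows b L (ν X) ≡ map (windowGaps S? b) (filter kept? X)
    zetaRows-ν []      _            _            _                = refl
    zetaRows-ν (h ∷ X) (h> ∷ desc) (h>0 ∷ X>0) (agree-h ∷ agree-X)
      rewrite firstColumnHook h X desc h> X>0 h>0 with kept? h
    ... | yes _ = cong₂ _∷_ (keptRow-length h X desc h> (agree-drop-head ≤-refl agree-h))
                            (zetaRows-ν X desc X>0 (agree-tail h> agree-X))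
    ... | no _  = zetaRows-ν X desc X>0 (agree-tail h> agree-X)

module Paths where

  open import Defs using (Step; N; E; Word; wordAux)
  open import Data.Nat
  open import Data.Nat.Properties
  open import Data.List using (List; []; _∷_; _++_; length; replicate; concatMap; upTo)
  open import Data.List.Properties using (++-identityʳ)
  open import Data.List.Relation.Unary.All as All using (All; []; _∷_)
  open import Data.List.Relation.Unary.AllPairs using (AllPairs; []; _∷_)
  open import Data.List.Membership.Propositional using (_∈_)
  open import Data.List.Membership.Propositional.Properties using (∈-++⁻)
  open import Data.List.Relation.Unary.Any using (here; there)
  open import Data.Product using (_×_; _,_; proj₁; ∃-syntax)
  open import Data.Sum using (inj₁; inj₂)
  open import Data.Empty using (⊥-elim)
  open import Relation.Nullary using (Dec; yes; no)
  open import Relation.Binary.PropositionalEquality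
  open Counting using (concatMap-upTo-suc; count)

  countN countE : Word → ℕ
  countN []      = 0
  countN (N ∷ w) = suc (countN w)
  countN (E ∷ w) = countN w
  countE []      = 0
  countE (N ∷ w) = countE w
  countE (E ∷ w) = suc (countE w)

  countN-++ : ∀ xs ys → countN (xs ++ ys) ≡ countN xs + countN ys
  countN-++ []       ys = refl
  countN-++ (N ∷ xs) ys = cong suc (countN-++ xs ys)
  countN-++ (E ∷ xs) ys = countN-++ xs ys

  countE-++ : ∀ xs ys → countE (xs ++ ys) ≡ countE xs + countE ys
  countE-++ []       ys = refl
  countE-++ (N ∷ xs) ys = countE-++ xs ys
  countE-++ (E ∷ xs) ys = cong suc (countE-++ xs ys)

  countN-Es : ∀ k → countN (replicate k E) ≡ 0
  countN-Es zero    = refl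
  countN-Es (suc k) = countN-Es k

  countE-Es : ∀ k → countE (replicate k E) ≡ k
  countE-Es zero    = refl
  countE-Es (suc k) = cong suc (countE-Es k)

  length-countN-countE : ∀ w → length w ≡ countN w + countE w
  length-countN-countE []      = refl
  length-countN-countE (N ∷ w) = cong suc (length-countN-countE w)
  length-countN-countE (E ∷ w) = trans (cong suc (length-countN-countE w)) (sym (+-suc (countN w) (countE w)))

  eastCounts : ℕ → Word → List ℕ
  eastCounts c []      = []
  eastCounts c (N ∷ w) = c ∷ eastCounts c w
  eastCounts c (E ∷ w) = eastCounts (suc c) w

  eastCounts-++ : ∀ c xs ys → eastCounts c (xs ++ ys) ≡ eastCounts c xs ++ eastCounts (c + countE xs) ys
  eastCounts-++ c []       ys = cong (λ k → eastCounts k ys) (sym (+-identityʳ c))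
  eastCounts-++ c (N ∷ xs) ys = cong (c ∷_) (eastCounts-++ c xs ys)
  eastCounts-++ c (E ∷ xs) ys =
    trans (eastCounts-++ (suc c) xs ys) (cong (λ k → eastCounts (suc c) xs ++ eastCounts k ys) (sym (+-suc c (countE xs))))

  wordAux-eastCounts : ∀ b c d w → c ≤ d → d + countE w ≡ b →
    wordAux b c (eastCounts d w) ≡ replicate (d ∸ c) E ++ w
  wordAux-eastCounts b c d []      c≤d total rewrite +-identityʳ d | total = sym (++-identityʳ _)
  wordAux-eastCounts b c d (N ∷ w) c≤d total =
    cong (λ z → replicate (d ∸ c) E ++ N ∷ z)
      (trans (wordAux-eastCounts b d d w ≤-refl total) (cong (λ k → replicate k E ++ w) (n∸n≡0 d)))
  wordAux-eastCounts b c d (E ∷ w) c≤d total =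
    trans (wordAux-eastCounts b c (suc d) w (m≤n⇒m≤1+n c≤d) (trans (sym (+-suc d (countE w))) total))
          (trans (cong (λ k → replicate k E ++ w) (+-∸-assoc 1 c≤d)) (shift (d ∸ c)))
    where
    shift : ∀ n → replicate (suc n) E ++ w ≡ replicate n E ++ (E ∷ w)
    shift zero    = refl
    shift (suc n) = cong (E ∷_) (shift n)

  eastCounts-blocks : (blk : ℕ → Word) → (∀ k → length (blk k) ≤ 1) → ∀ K →
    eastCounts 0 (concatMap blk (upTo K)) ≡
    concatMap (λ k → replicate (countN (blk k)) (countE (concatMap blk (upTo k)))) (upTo K)
  eastCounts-blocks blk short zero    = refl
  eastCounts-blocks blk short (suc K) = begin
    eastCounts 0 (concatMap blk (upTo (suc K)))
      ≡⟨ cong (eastCounts 0) (concatMap-upTo-suc blk K) ⟩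
    eastCounts 0 (concatMap blk (upTo K) ++ blk K)
      ≡⟨ eastCounts-++ 0 (concatMap blk (upTo K)) (blk K) ⟩
    eastCounts 0 (concatMap blk (upTo K)) ++ eastCounts (countE (concatMap blk (upTo K))) (blk K)
      ≡⟨ cong₂ _++_ (eastCounts-blocks blk short K) (single (countE (concatMap blk (upTo K))) (blk K) (short K)) ⟩
    concatMap counts (upTo K) ++ counts K
      ≡⟨ sym (concatMap-upTo-suc counts K) ⟩
    concatMap counts (upTo (suc K)) ∎
    where
    open ≡-Reasoning
    counts : ℕ → List ℕ
    counts k = replicate (countN (blk k)) (countE (concatMap blk (upTo k)))
    single : ∀ c w → length w ≤ 1 → eastCounts c w ≡ replicate (countN w) c
    single c []          _ = refl
    single c (N ∷ [])    _ = refl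
    single c (E ∷ [])    _ = refl
    single c (_ ∷ _ ∷ _) (s≤s ())

  -- A step of a path together with its starting point (x , y).
  Point : Set
  Point = Step × ℕ × ℕ

  stepsFrom : ℕ → ℕ → Word → List Point
  stepsFrom x y []      = []
  stepsFrom x y (N ∷ w) = (N , x , y) ∷ stepsFrom x (suc y) w
  stepsFrom x y (E ∷ w) = (E , x , y) ∷ stepsFrom (suc x) y w

  stepsFrom-++ : ∀ x y w w′ → stepsFrom x y (w ++ w′) ≡ stepsFrom x y w ++ stepsFrom (x + countE w) (y + countN w) w′
  stepsFrom-++ x y []      w′ rewrite +-identityʳ x | +-identityʳ y = refl
  stepsFrom-++ x y (N ∷ w) w′ rewrite +-suc y (countN w) = cong ((N , x , y) ∷_) (stepsFrom-++ x (suc y) w w′)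
  stepsFrom-++ x y (E ∷ w) w′ rewrite +-suc x (countE w) = cong ((E , x , y) ∷_) (stepsFrom-++ (suc x) y w w′)

  eastRun : ℕ → ℕ → ℕ → List Point
  eastRun x x′ y = stepsFrom x y (replicate (x′ ∸ x) E)

  eastRun-∈ : ∀ {x x′ y p} → p ∈ eastRun x x′ y → ∃[ x₁ ] (p ≡ (E , x₁ , y) × x ≤ x₁ × x₁ < x′)
  eastRun-∈ {x} {x′} {y} p∈ with go (x′ ∸ x) x p∈
    where
    go : ∀ k x₀ {p} → p ∈ stepsFrom x₀ y (replicate k E) → ∃[ x₁ ] (p ≡ (E , x₁ , y) × x₀ ≤ x₁ × x₁ < x₀ + k)
    go (suc k) x₀ (here refl) = x₀ , refl , ≤-refl , m<m+n x₀ (s≤s z≤n)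
    go (suc k) x₀ (there p∈) with go k (suc x₀) p∈
    ... | x₁ , refl , x₀<x₁ , x₁< = x₁ , refl , <⇒≤ x₀<x₁ , subst (x₁ <_) (sym (+-suc x₀ k)) x₁<
  ... | x₁ , refl , x≤x₁ , x₁< = x₁ , refl , x≤x₁ , subst (x₁ <_) (m+[n∸m]≡n x≤x′) x₁<
    where
    x≤x′ : x ≤ x′
    x≤x′ with x ≤? x′
    ... | yes x≤x′ = x≤x′
    ... | no x≰x′ = ⊥-elim (<-irrefl refl (<-≤-trans x₁<
                      (subst (_≤ x₁) (sym (trans (cong (x +_) (m≤n⇒m∸n≡0 (<⇒≤ (≰⇒> x≰x′)))) (+-identityʳ x))) x≤x₁)))

  -- The right end of row d of the path: the d-th part, or b above the top row.
  rowEnd : ℕ → List ℕ → ℕ → ℕ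
  rowEnd b []       d       = b
  rowEnd b (q ∷ qs) zero    = q
  rowEnd b (q ∷ qs) (suc d) = rowEnd b qs d

  rowStart : ℕ → ℕ → List ℕ → ℕ → ℕ
  rowStart b prev qs zero    = prev
  rowStart b prev qs (suc d) = rowEnd b qs d

  module _ (b : ℕ) where

    Increasing : ℕ → List ℕ → Set
    Increasing prev qs = AllPairs _≤_ (prev ∷ qs)

    stepsFrom-row : ∀ prev q qs y → prev ≤ q →
      stepsFrom prev y (wordAux b prev (q ∷ qs)) ≡ eastRun prev q y ++ (N , q , y) ∷ stepsFrom q (suc y) (wordAux b q qs)
    stepsFrom-row prev q qs y prev≤q
      rewrite stepsFrom-++ prev y (replicate (q ∸ prev) E) (N ∷ wordAux b q qs)
            | countE-Es (q ∸ prev) | countN-Es (q ∸ prev) | +-identityʳ y | m+[n∸m]≡n prev≤q = refl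

    eastStep-∈ : ∀ prev y₀ qs → Increasing prev qs → ∀ {x y} → (E , x , y) ∈ stepsFrom prev y₀ (wordAux b prev qs) →
      ∃[ d ] (y ≡ y₀ + d × d ≤ length qs × rowStart b prev qs d ≤ x × x < rowEnd b qs d)
    eastStep-∈ prev y₀ [] _ E∈ with eastRun-∈ E∈
    ... | x₁ , refl , le , lt = 0 , sym (+-identityʳ y₀) , z≤n , le , lt
    eastStep-∈ prev y₀ (q ∷ qs) ((prev≤q ∷ _) ∷ inc) E∈
      rewrite stepsFrom-row prev q qs y₀ prev≤q with ∈-++⁻ (eastRun prev q y₀) E∈
    ... | inj₁ E∈run with eastRun-∈ E∈run
    ...   | x₁ , refl , le , lt = 0 , sym (+-identityʳ y₀) , z≤n , le , lt
    eastStep-∈ prev y₀ (q ∷ qs) ((prev≤q ∷ _) ∷ inc) E∈ | inj₂ (there E∈rest) with eastStep-∈ q (suc y₀) qs inc E∈rest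
    ... | d , refl , d≤ , le , lt = suc d , sym (+-suc y₀ d) , s≤s d≤ , start d le , lt
      where
      start : ∀ d {x} → rowStart b q qs d ≤ x → rowStart b prev (q ∷ qs) (suc d) ≤ x
      start zero    le = le
      start (suc d) le = le

    northStep-∈ : ∀ prev y₀ qs → Increasing prev qs → ∀ {x y} → (N , x , y) ∈ stepsFrom prev y₀ (wordAux b prev qs) →
      ∃[ d ] (d < length qs × y ≡ y₀ + d × x ≡ rowEnd b qs d)
    northStep-∈ prev y₀ [] _ N∈ with eastRun-∈ N∈
    ... | _ , () , _
    northStep-∈ prev y₀ (q ∷ qs) ((prev≤q ∷ _) ∷ inc) N∈
      rewrite stepsFrom-row prev q qs y₀ prev≤q with ∈-++⁻ (eastRun prev q y₀) N∈
    ... | inj₁ N∈run with eastRun-∈ N∈run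
    ...   | _ , () , _
    northStep-∈ prev y₀ (q ∷ qs) ((prev≤q ∷ _) ∷ inc) N∈ | inj₂ (here refl) = 0 , s≤s z≤n , sym (+-identityʳ y₀) , refl
    northStep-∈ prev y₀ (q ∷ qs) ((prev≤q ∷ _) ∷ inc) N∈ | inj₂ (there N∈rest) with northStep-∈ q (suc y₀) qs inc N∈rest
    ... | d , d< , refl , x≡ = suc d , s≤s d< , sym (+-suc y₀ d) , x≡

    countE-wordAux : ∀ prev qs → Increasing prev qs → All (_≤ b) (prev ∷ qs) → countE (wordAux b prev qs) ≡ b ∸ prev
    countE-wordAux prev []       _                    _                   = countE-Es (b ∸ prev)
    countE-wordAux prev (q ∷ qs) ((prev≤q ∷ _) ∷ inc) (_ ∷ q≤b ∷ qs≤b) = begin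
      countE (replicate (q ∸ prev) E ++ N ∷ wordAux b q qs)       ≡⟨ countE-++ (replicate (q ∸ prev) E) (N ∷ wordAux b q qs) ⟩
      countE (replicate (q ∸ prev) E) + countE (wordAux b q qs)  ≡⟨ cong₂ _+_ (countE-Es (q ∸ prev)) (countE-wordAux q qs inc (q≤b ∷ qs≤b)) ⟩
      (q ∸ prev) + (b ∸ q)                                        ≡⟨ +-comm (q ∸ prev) (b ∸ q) ⟩
      (b ∸ q) + (q ∸ prev)                                        ≡⟨ sym (+-∸-assoc (b ∸ q) prev≤q) ⟩
      (b ∸ q) + q ∸ prev                                          ≡⟨ cong (_∸ prev) (m∸n+n≡m q≤b) ⟩
      b ∸ prev                                                    ∎
      where open ≡-Reasoning

    countN-wordAux : ∀ prev qs → countN (wordAux b prev qs) ≡ length qs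
    countN-wordAux prev []       = countN-Es (b ∸ prev)
    countN-wordAux prev (q ∷ qs) =
      trans (countN-++ (replicate (q ∸ prev) E) (N ∷ wordAux b q qs))
            (cong₂ _+_ (countN-Es (q ∸ prev)) (cong suc (countN-wordAux q qs)))

  diagonal : Point → ℕ
  diagonal (s , x , y) = x + y

  stepsFrom-diagonal-≥ : ∀ x y w → All (λ p → x + y ≤ diagonal p) (stepsFrom x y w)
  stepsFrom-diagonal-≥ x y []      = []
  stepsFrom-diagonal-≥ x y (N ∷ w) =
    ≤-refl ∷ All.map (≤-trans (subst (x + y ≤_) (sym (+-suc x y)) (n≤1+n (x + y)))) (stepsFrom-diagonal-≥ x (suc y) w)
  stepsFrom-diagonal-≥ x y (E ∷ w) =
    ≤-refl ∷ All.map (≤-trans (n≤1+n (x + y))) (stepsFrom-diagonal-≥ (suc x) y w)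

  stepsFrom-diagonal-< : ∀ x y w → AllPairs (λ p q → diagonal p < diagonal q) (stepsFrom x y w)
  stepsFrom-diagonal-< x y []      = []
  stepsFrom-diagonal-< x y (N ∷ w) =
    All.map (λ {p} → subst (_≤ diagonal p) (+-suc x y)) (stepsFrom-diagonal-≥ x (suc y) w) ∷ stepsFrom-diagonal-< x (suc y) w
  stepsFrom-diagonal-< x y (E ∷ w) = stepsFrom-diagonal-≥ (suc x) y w ∷ stepsFrom-diagonal-< (suc x) y w

  isN? : (s : Step) → Dec (s ≡ N)
  isN? N = yes refl
  isN? E = no (λ ())

  isE? : (s : Step) → Dec (s ≡ E)
  isE? E = yes refl
  isE? N = no (λ ())

  count-N-stepsFrom : ∀ x y w → count (λ p → isN? (proj₁ p)) (stepsFrom x y w) ≡ countN w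
  count-N-stepsFrom x y []      = refl
  count-N-stepsFrom x y (N ∷ w) = cong suc (count-N-stepsFrom x (suc y) w)
  count-N-stepsFrom x y (E ∷ w) = count-N-stepsFrom (suc x) y w

  count-E-stepsFrom : ∀ x y w → count (λ p → isE? (proj₁ p)) (stepsFrom x y w) ≡ countE w
  count-E-stepsFrom x y []      = refl
  count-E-stepsFrom x y (N ∷ w) = count-E-stepsFrom x (suc y) w
  count-E-stepsFrom x y (E ∷ w) = cong suc (count-E-stepsFrom (suc x) y w)

module Squares where

  open import Defs using (squaresRow; squaresFrom)
  open Paths using (rowEnd)
  open import Data.Nat
  open import Data.Nat.Properties
  open import Data.Bool using (if_then_else_)
  open import Data.List using (List; []; _∷_; length; upTo; concatMap)
  open import Data.List.Membership.Propositional using (_∈_; find; lose)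
  open import Data.List.Membership.Propositional.Properties using (∈-++⁺ˡ; ∈-++⁺ʳ; ∈-++⁻; ∈-upTo⁺; ∈-upTo⁻)
  import Data.List.Relation.Unary.Any.Properties as Any
  open import Data.List.Relation.Unary.Any using (here)
  open import Data.Product using (_×_; _,_; ∃-syntax)
  open import Data.Sum using (inj₁; inj₂)
  open import Data.Empty using (⊥-elim)
  open import Relation.Nullary using (Dec; yes; no; does)
  open import Relation.Binary.PropositionalEquality
  open import Data.List.Relation.Unary.All as All using (All; [])
  open import Data.List.Relation.Unary.AllPairs using (AllPairs; []; _∷_)
  import Data.List.Relation.Unary.AllPairs.Properties as AllPairs
  open import Data.List.Relation.Unary.Any using (Any)
  open Sorting using (upTo-ascending)

  if-∈⁻ : ∀ {A : Set} {P : Set} (d : Dec P) {xs : List A} {m} → m ∈ (if does d then xs else []) → P × m ∈ xs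
  if-∈⁻ (yes p) m∈ = p , m∈
  if-∈⁻ (no _)  ()

  if-∈⁺ : ∀ {A : Set} {P : Set} (d : Dec P) {xs : List A} {m} → P → m ∈ xs → m ∈ (if does d then xs else [])
  if-∈⁺ (yes _) _ m∈ = m∈
  if-∈⁺ (no ¬p) p _  = ⊥-elim (¬p p)

  module _ (a b : ℕ) where

    -- The unit square with lower-left corner (i , j) lies east of column q and has positive level m.
    SquareInRow : ℕ → ℕ → ℕ → ℕ → Set
    SquareInRow j q m i = i < b × q ≤ i × a * suc i < b * j × m ≡ b * j ∸ a * suc i

    squareAt : ℕ → ℕ → ℕ → List ℕ
    squareAt j q i = if does (q ≤? i)
                     then (if does ((a * suc i) <? (b * j)) then (b * j ∸ a * suc i) ∷ [] else [])
                     else []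

    squaresRow-∈ : ∀ j q {m} → m ∈ squaresRow a b j q → ∃[ i ] SquareInRow j q m i
    squaresRow-∈ j q m∈ with find (Any.concatMap⁻ (squareAt j q) {xs = upTo b} m∈)
    ... | i , i∈ , m∈i with if-∈⁻ (q ≤? i) m∈i
    ...   | q≤i , m∈′ with if-∈⁻ ((a * suc i) <? (b * j)) m∈′
    ...     | lt , here refl = i , ∈-upTo⁻ i∈ , q≤i , lt , refl

    squaresRow-∈⁺ : ∀ j q {m} i → SquareInRow j q m i → m ∈ squaresRow a b j q
    squaresRow-∈⁺ j q i (i<b , q≤i , lt , refl) =
      Any.concatMap⁺ (squareAt j q) {xs = upTo b} (lose (∈-upTo⁺ i<b) (if-∈⁺ (q ≤? i) q≤i (if-∈⁺ ((a * suc i) <? (b * j)) lt (here refl))))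

    squaresFrom-∈ : ∀ j₀ qs {m} → m ∈ squaresFrom a b j₀ qs →
      ∃[ d ] ∃[ i ] (d < length qs × SquareInRow (j₀ + d) (rowEnd b qs d) m i)
    squaresFrom-∈ j₀ (q ∷ qs) {m} m∈ with ∈-++⁻ (squaresRow a b j₀ q) m∈
    ... | inj₁ m∈row with squaresRow-∈ j₀ q m∈row
    ...   | i , sq = 0 , i , s≤s z≤n , subst (λ j → SquareInRow j q m i) (sym (+-identityʳ j₀)) sq
    squaresFrom-∈ j₀ (q ∷ qs) {m} m∈ | inj₂ m∈rest with squaresFrom-∈ (suc j₀) qs m∈rest
    ... | d , i , d< , sq = suc d , i , s≤s d< , subst (λ j → SquareInRow j (rowEnd b qs d) m i) (sym (+-suc j₀ d)) sq

    squaresFrom-∈⁺ : ∀ j₀ qs {m} d i → d < length qs → SquareInRow (j₀ + d) (rowEnd b qs d) m i → m ∈ squaresFrom a b j₀ qs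
    squaresFrom-∈⁺ j₀ (q ∷ qs) {m} zero i _ sq =
      ∈-++⁺ˡ (squaresRow-∈⁺ j₀ q i (subst (λ j → SquareInRow j q m i) (+-identityʳ j₀) sq))
    squaresFrom-∈⁺ j₀ (q ∷ qs) {m} (suc d) i (s≤s d<) sq =
      ∈-++⁺ʳ (squaresRow a b j₀ q) (squaresFrom-∈⁺ (suc j₀) qs d i d< (subst (λ j → SquareInRow j (rowEnd b qs d) m i) (+-suc j₀ d) sq))

  equal-differences : ∀ {B A B′ A′ v} → A < B → A′ < B′ → v ≡ B ∸ A → v ≡ B′ ∸ A′ → B + A′ ≡ B′ + A
  equal-differences {B} {A} {B′} {A′} A<B A′<B′ v≡ v≡′ = begin
    B + A′             ≡⟨ cong (_+ A′) (sym (m∸n+n≡m (<⇒≤ A<B))) ⟩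
    B ∸ A + A + A′     ≡⟨ +-assoc (B ∸ A) A A′ ⟩
    B ∸ A + (A + A′)   ≡⟨ cong₂ _+_ (trans (sym v≡) v≡′) (+-comm A A′) ⟩
    B′ ∸ A′ + (A′ + A) ≡⟨ sym (+-assoc (B′ ∸ A′) A′ A) ⟩
    B′ ∸ A′ + A′ + A   ≡⟨ cong (_+ A) (m∸n+n≡m (<⇒≤ A′<B′)) ⟩
    B′ + A             ∎
    where open ≡-Reasoning

  -- Within one row the levels strictly decrease from left to right, so they are distinct.
  squaresRow-distinct : ∀ a b .{{_ : NonZero a}} j q → AllPairs (λ v w → v ≢ w) (squaresRow a b j q)
  squaresRow-distinct a b j q = columns (upTo b) (upTo-ascending b)
    where
    at-most-one : ∀ {X Y : Set} (dX : Dec X) (dY : Dec Y) (v : ℕ) →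
      AllPairs (λ v w → v ≢ w) (if does dX then (if does dY then v ∷ [] else []) else [])
    at-most-one (yes _) (yes _) v = [] ∷ []
    at-most-one (yes _) (no _)  v = []
    at-most-one (no _)  _       v = []
    squareAt-∈ : ∀ {i v} → v ∈ squareAt a b j q i → a * suc i < b * j × v ≡ b * j ∸ a * suc i
    squareAt-∈ {i} v∈ with if-∈⁻ (q ≤? i) v∈
    ... | _ , v∈′ with if-∈⁻ ((a * suc i) <? (b * j)) v∈′
    ...   | lt , here refl = lt , refl
    columns : ∀ is → AllPairs _<_ is → AllPairs (λ v w → v ≢ w) (concatMap (squareAt a b j q) is)
    columns []       _            = []
    columns (i ∷ is) (i< ∷ asc) =
      AllPairs.++⁺ (at-most-one (q ≤? i) ((a * suc i) <? (b * j)) (b * j ∸ a * suc i)) (columns is asc)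
        (All.tabulate (λ v∈ → All.tabulate (λ w∈ → differ v∈ w∈)))
      where
      differ : ∀ {v w} → v ∈ squareAt a b j q i → w ∈ concatMap (squareAt a b j q) is → v ≢ w
      differ v∈ w∈ v≡w with squareAt-∈ v∈ | find (Any.concatMap⁻ (squareAt a b j q) {xs = is} w∈)
      ... | lt , refl | i′ , i′∈ , w∈′ with squareAt-∈ {i′} w∈′
      ...   | lt′ , refl =
        <-irrefl (suc-injective (*-cancelˡ-≡ (suc i) (suc i′) a (∸-cancelˡ-≡ (<⇒≤ lt) (<⇒≤ lt′) v≡w))) (All.lookup i< i′∈)

-- The arithmetic input: for coprime a and b, distinct lattice points of the rectangle
-- [0,b]×[0,a] (other than the two corners (0,0), (b,a)) have distinct levels b·y − a·x.
module Lattice where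

  open import Data.Nat
  open import Data.Nat.Properties
  open import Data.Nat.Divisibility using (_∣_; ∣⇒≤; ∣m+n∣m⇒∣n; m∣m*n)
  open import Data.Nat.Coprimality using (Coprime; coprime-divisor)
  open import Data.Nat.Tactic.RingSolver using (solve-∀)
  open import Data.Product using (_×_; _,_)
  open import Data.Sum using (_⊎_; inj₁; inj₂)
  open import Data.Empty using (⊥-elim)
  open import Relation.Binary.PropositionalEquality
  open import Relation.Nullary using (yes; no)
  open import Data.Empty using (⊥)

  module LevelCollision (a b : ℕ) (a>0 : 0 < a) (cop : Coprime a b) where

    instance
      a≢0 : NonZero a
      a≢0 = >-nonZero a>0

    small-multiple : ∀ d → a ∣ d → d ≤ a → d ≡ 0 ⊎ d ≡ a
    small-multiple zero    _   _   = inj₁ refl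
    small-multiple (suc d) a∣d d≤a = inj₂ (≤-antisym d≤a (∣⇒≤ a∣d))

    divides-height : ∀ d u v → b * d + a * u ≡ a * v → a ∣ d
    divides-height d u v eq =
      coprime-divisor cop (∣m+n∣m⇒∣n (subst (a ∣_) (trans (sym eq) (+-comm (b * d) (a * u))) (m∣m*n v)) (m∣m*n u))

    private
      shuffle : ∀ b y d a x → b * y + (b * d + a * x) ≡ b * (y + d) + a * x
      shuffle = solve-∀

      cancel : ∀ {y d x x′} → b * (y + d) + a * x′ ≡ b * y + a * x → b * d + a * x′ ≡ a * x
      cancel {y} {d} {x} {x′} eq = +-cancelˡ-≡ (b * y) _ _ (trans (shuffle b y d a x′) eq)

      no-height : ∀ {x x′} → b * 0 + a * x′ ≡ a * x → a * x′ ≡ a * x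
      no-height {x} {x′} eq = trans (cong (_+ a * x′) (sym (*-zeroʳ b))) eq

    level-collision : ∀ {x y x′ y′} → x ≤ b → y ≤ a → x′ ≤ b → y′ < a →
      b * y + a * x′ ≡ b * y′ + a * x →
      (x ≡ x′ × y ≡ y′) ⊎ (x ≡ b × y ≡ a × x′ ≡ 0 × y′ ≡ 0)
    level-collision {x} {y} {x′} {y′} x≤b y≤a x′≤b y′<a eq with ≤-total y′ y
    ... | inj₁ y′≤y = higher (y ∸ y′) (m+[n∸m]≡n y′≤y) eq
      where
      higher : ∀ d → y′ + d ≡ y → b * y + a * x′ ≡ b * y′ + a * x → (x ≡ x′ × y ≡ y′) ⊎ (x ≡ b × y ≡ a × x′ ≡ 0 × y′ ≡ 0)
      higher d refl eq with small-multiple d (divides-height d x′ x (cancel eq)) (≤-trans (m≤n+m d y′) y≤a)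
      ... | inj₁ refl = inj₁ (*-cancelˡ-≡ x x′ a (sym (no-height (cancel eq))) , +-identityʳ y′)
      ... | inj₂ refl = inj₂ (x≡b , y′+a≡a , x′≡0 , y′≡0)
        where
        y′≡0 : y′ ≡ 0
        y′≡0 = n≤0⇒n≡0 (+-cancelʳ-≤ a y′ 0 y≤a)
        y′+a≡a : y′ + a ≡ a
        y′+a≡a = cong (_+ a) y′≡0
        b+x′≡x : b + x′ ≡ x
        b+x′≡x = *-cancelˡ-≡ (b + x′) x a (trans (*-distribˡ-+ a b x′) (trans (cong (_+ a * x′) (*-comm a b)) (cancel eq)))
        x′≡0 : x′ ≡ 0
        x′≡0 = n≤0⇒n≡0 (+-cancelˡ-≤ b x′ 0 (subst (_≤ b + 0) (sym b+x′≡x) (subst (x ≤_) (sym (+-identityʳ b)) x≤b)))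
        x≡b : x ≡ b
        x≡b = trans (sym b+x′≡x) (trans (cong (b +_) x′≡0) (+-identityʳ b))
    ... | inj₂ y≤y′ = lower (y′ ∸ y) (m+[n∸m]≡n y≤y′) eq
      where
      lower : ∀ d → y + d ≡ y′ → b * y + a * x′ ≡ b * y′ + a * x → (x ≡ x′ × y ≡ y′) ⊎ (x ≡ b × y ≡ a × x′ ≡ 0 × y′ ≡ 0)
      lower d refl eq with small-multiple d (divides-height d x x′ (cancel (sym eq))) (<⇒≤ d<a)
        where
        d<a : d < a
        d<a = ≤-<-trans (m≤n+m d y) y′<a
      ... | inj₁ refl = inj₁ (sym (*-cancelˡ-≡ x′ x a (sym (no-height (cancel (sym eq))))) , sym (+-identityʳ y))
      ... | inj₂ refl = ⊥-elim (<-irrefl refl (≤-<-trans (m≤n+m a y) y′<a))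

    not-corner : ∀ {x y} → (x < b ⊎ y < a) → x ≡ b → y ≡ a → ⊥
    not-corner (inj₁ x<b) refl _ = <-irrefl refl x<b
    not-corner (inj₂ y<a) _ refl = <-irrefl refl y<a

    level-injective : ∀ {x y x′ y′} → x ≤ b → y ≤ a → x′ ≤ b → y′ ≤ a → (x < b ⊎ y < a) → (x′ < b ⊎ y′ < a) →
      b * y + a * x′ ≡ b * y′ + a * x → x ≡ x′ × y ≡ y′
    level-injective {x} {y} {x′} {y′} x≤b y≤a x′≤b y′≤a inside inside′ eq with y′ <? a | y <? a
    ... | yes y′<a | _ with level-collision x≤b y≤a x′≤b y′<a eq
    ...   | inj₁ same = same
    ...   | inj₂ (x≡b , y≡a , _) = ⊥-elim (not-corner inside x≡b y≡a)
    level-injective {x} {y} {x′} {y′} x≤b y≤a x′≤b y′≤a inside inside′ eq | no _ | yes y<a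
      with level-collision x′≤b y′≤a x≤b y<a (sym eq)
    ...   | inj₁ (x′≡x , y′≡y) = sym x′≡x , sym y′≡y
    ...   | inj₂ (x′≡b , y′≡a , _) = ⊥-elim (not-corner inside′ x′≡b y′≡a)
    level-injective {x} {y} {x′} {y′} x≤b y≤a x′≤b y′≤a inside inside′ eq | no y′≮a | no y≮a = x≡x′ , y≡y′
      where
      y≡y′ : y ≡ y′
      y≡y′ = trans (≤-antisym y≤a (≮⇒≥ y≮a)) (sym (≤-antisym y′≤a (≮⇒≥ y′≮a)))
      x≡x′ : x ≡ x′
      x≡x′ = *-cancelˡ-≡ x x′ a (sym (+-cancelˡ-≡ (b * y) (a * x′) (a * x) (trans eq (cong (λ z → b * z + a * x) (sym y≡y′)))))

module Levels where

  open import Defs using (Step; N; E; Word; levelsFrom; select; eastLevelsFrom)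
  open Counting using (count)
  open Paths using (Point; stepsFrom; countN; countE; isN?; isE?)
  open import Data.Nat as ℕ using (ℕ; zero; suc; _≤_)
  import Data.Nat.Properties as ℕ
  open import Data.Integer as ℤ using (ℤ; +_; _+_; _-_; -_; +0)
  import Data.Integer.Properties as ℤ
  open import Data.Integer.Tactic.RingSolver using (solve-∀)
  open import Data.List using (List; []; _∷_; _++_; reverse; map; length)
  open import Data.List.Properties using (unfold-reverse; map-cong; map-∘)
  open import Data.List.Membership.Propositional using (_∈_)
  open import Data.List.Relation.Unary.Any using (Any; here; there)
  open import Data.Product using (_×_; _,_; proj₁; proj₂; ∃-syntax)
  open import Data.Empty using (⊥)
  open import Relation.Nullary using (yes; no; _×-dec_)
  open import Relation.Binary.PropositionalEquality

  private
    minus-plus : ∀ i j → i ≡ (i - j) + j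
    minus-plus = solve-∀

    plus-minus : ∀ i j → i ≡ (i + j) - j
    plus-minus = solve-∀

  difference⁻ : ∀ {c B A} → + B - + A ≡ + c → B ≡ c ℕ.+ A
  difference⁻ {c} {B} {A} eq = ℤ.+-injective (begin
    + B               ≡⟨ minus-plus (+ B) (+ A) ⟩
    (+ B - + A) + + A ≡⟨ cong (_+ + A) eq ⟩
    + c + + A         ≡⟨ sym (ℤ.pos-+ c A) ⟩
    + (c ℕ.+ A)       ∎)
    where open ≡-Reasoning

  difference⁺ : ∀ {c B A} → B ≡ c ℕ.+ A → + B - + A ≡ + c
  difference⁺ {c} {B} {A} refl = begin
    + (c ℕ.+ A) - + A     ≡⟨ cong (_- + A) (ℤ.pos-+ c A) ⟩
    (+ c + + A) - + A     ≡⟨ sym (plus-minus (+ c) (+ A)) ⟩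
    + c                   ∎
    where open ≡-Reasoning

  difference-∸ : ∀ {B A} → A ≤ B → + B - + A ≡ + (B ℕ.∸ A)
  difference-∸ {B} {A} A≤B = difference⁺ (sym (ℕ.m∸n+n≡m A≤B))

  difference-nonnegative : ∀ {B A} → + 0 ℤ.≤ + B - + A → A ≤ B
  difference-nonnegative {B} {A} 0≤ =
    subst (A ≤_) (sym (difference⁻ {ℤ.∣ + B - + A ∣} {B} {A} (sym (ℤ.0≤i⇒+∣i∣≡i 0≤)))) (ℕ.m≤n+m A _)

  neg-injective : ∀ {l k} → - (+ l) ≡ - (+ k) → l ≡ k
  neg-injective eq = ℤ.+-injective (ℤ.neg-injective eq)

  neg≢pos : ∀ {l m} → - (+ l) ≡ + suc m → ⊥
  neg≢pos {zero}  ()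
  neg≢pos {suc l} ()

  module AtSlope (a b : ℕ) where

    stepLevel : Step → ℤ
    stepLevel N = + b
    stepLevel E = - (+ a)

    totalLevel : Word → ℤ
    totalLevel []      = +0
    totalLevel (s ∷ w) = stepLevel s + totalLevel w

    -- Each letter paired with the level at which it starts (levelsFrom records the end level).
    startLevelsFrom : ℤ → Word → List (Step × ℤ)
    startLevelsFrom l []      = []
    startLevelsFrom l (s ∷ w) = (s , l) ∷ startLevelsFrom (l + stepLevel s) w

    pointLevel : ℕ → ℕ → ℤ
    pointLevel x y = + (b ℕ.* y) - + (a ℕ.* x)

    private
      shuffle-N : ∀ B A b′ → B - A + b′ ≡ (b′ + B) - A
      shuffle-N = solve-∀
      shuffle-E : ∀ B A a′ → B - A - a′ ≡ B - (a′ + A)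
      shuffle-E = solve-∀
      shuffle-last : ∀ c t x → c + t + x ≡ (c + (x + t)) - +0
      shuffle-last = solve-∀
      shuffle-shift : ∀ c d t v → (c + (d + t)) - (d + v) ≡ (c + t) - v
      shuffle-shift = solve-∀

    pointLevel-N : ∀ x y → pointLevel x y + + b ≡ pointLevel x (suc y)
    pointLevel-N x y rewrite ℕ.*-suc b y | ℤ.pos-+ b (b ℕ.* y) = shuffle-N (+ (b ℕ.* y)) (+ (a ℕ.* x)) (+ b)

    pointLevel-E : ∀ x y → pointLevel x y - + a ≡ pointLevel (suc x) y
    pointLevel-E x y rewrite ℕ.*-suc a x | ℤ.pos-+ a (a ℕ.* x) = shuffle-E (+ (b ℕ.* y)) (+ (a ℕ.* x)) (+ a)

    pointLevel-origin : pointLevel 0 0 ≡ +0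
    pointLevel-origin rewrite ℕ.*-zeroʳ a | ℕ.*-zeroʳ b = refl

    totalLevel-counts : ∀ w → totalLevel w ≡ + (b ℕ.* countN w) - + (a ℕ.* countE w)
    totalLevel-counts []      rewrite ℕ.*-zeroʳ a | ℕ.*-zeroʳ b = refl
    totalLevel-counts (N ∷ w) rewrite totalLevel-counts w | ℕ.*-suc b (countN w) | ℤ.pos-+ b (b ℕ.* countN w) =
      trans (ℤ.+-comm (+ b) (+ (b ℕ.* countN w) - + (a ℕ.* countE w))) (shuffle-N (+ (b ℕ.* countN w)) (+ (a ℕ.* countE w)) (+ b))
    totalLevel-counts (E ∷ w) rewrite totalLevel-counts w | ℕ.*-suc a (countE w) | ℤ.pos-+ a (a ℕ.* countE w) =
      trans (ℤ.+-comm (- + a) (+ (b ℕ.* countN w) - + (a ℕ.* countE w))) (shuffle-E (+ (b ℕ.* countN w)) (+ (a ℕ.* countE w)) (+ a))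

    withStartLevel withEndLevel : Point → Step × ℤ
    withStartLevel (s , x , y) = (s , pointLevel x y)
    withEndLevel   (N , x , y) = (N , pointLevel x (suc y))
    withEndLevel   (E , x , y) = (E , pointLevel (suc x) y)

    startLevelsFrom-stepsFrom : ∀ x y w → startLevelsFrom (pointLevel x y) w ≡ map withStartLevel (stepsFrom x y w)
    startLevelsFrom-stepsFrom x y []      = refl
    startLevelsFrom-stepsFrom x y (N ∷ w) = cong ((N , pointLevel x y) ∷_)
      (trans (cong (λ l → startLevelsFrom l w) (pointLevel-N x y)) (startLevelsFrom-stepsFrom x (suc y) w))
    startLevelsFrom-stepsFrom x y (E ∷ w) = cong ((E , pointLevel x y) ∷_)
      (trans (cong (λ l → startLevelsFrom l w) (pointLevel-E x y)) (startLevelsFrom-stepsFrom (suc x) y w))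

    levelsFrom-stepsFrom : ∀ x y w → levelsFrom a b (pointLevel x y) w ≡ map withEndLevel (stepsFrom x y w)
    levelsFrom-stepsFrom x y []      = refl
    levelsFrom-stepsFrom x y (N ∷ w) rewrite pointLevel-N x y = cong ((N , pointLevel x (suc y)) ∷_) (levelsFrom-stepsFrom x (suc y) w)
    levelsFrom-stepsFrom x y (E ∷ w) rewrite pointLevel-E x y = cong ((E , pointLevel (suc x) y) ∷_) (levelsFrom-stepsFrom (suc x) y w)

    levelsFrom-++ : ∀ c xs ys → levelsFrom a b c (xs ++ ys) ≡ levelsFrom a b c xs ++ levelsFrom a b (c + totalLevel xs) ys
    levelsFrom-++ c []       ys = cong (λ l → levelsFrom a b l ys) (sym (ℤ.+-identityʳ c))
    levelsFrom-++ c (N ∷ xs) ys = cong ((N , c + + b) ∷_)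
      (trans (levelsFrom-++ (c + + b) xs ys) (cong (λ l → levelsFrom a b (c + + b) xs ++ levelsFrom a b l ys) (ℤ.+-assoc c (+ b) (totalLevel xs))))
    levelsFrom-++ c (E ∷ xs) ys = cong ((E , c - + a) ∷_)
      (trans (levelsFrom-++ (c - + a) xs ys) (cong (λ l → levelsFrom a b (c - + a) xs ++ levelsFrom a b l ys) (ℤ.+-assoc c (- + a) (totalLevel xs))))

    totalLevel-++ : ∀ xs ys → totalLevel (xs ++ ys) ≡ totalLevel xs + totalLevel ys
    totalLevel-++ []       ys = sym (ℤ.+-identityˡ (totalLevel ys))
    totalLevel-++ (s ∷ xs) ys = trans (cong (λ t → stepLevel s + t) (totalLevel-++ xs ys)) (sym (ℤ.+-assoc (stepLevel s) (totalLevel xs) (totalLevel ys)))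

    totalLevel-reverse : ∀ xs → totalLevel (reverse xs) ≡ totalLevel xs
    totalLevel-reverse []       = refl
    totalLevel-reverse (s ∷ xs) = begin
      totalLevel (reverse (s ∷ xs))                 ≡⟨ cong totalLevel (unfold-reverse s xs) ⟩
      totalLevel (reverse xs ++ s ∷ [])             ≡⟨ totalLevel-++ (reverse xs) (s ∷ []) ⟩
      totalLevel (reverse xs) + (stepLevel s + +0)  ≡⟨ cong₂ _+_ (totalLevel-reverse xs) (ℤ.+-identityʳ (stepLevel s)) ⟩
      totalLevel xs + stepLevel s                   ≡⟨ ℤ.+-comm (totalLevel xs) (stepLevel s) ⟩
      totalLevel (s ∷ xs)                           ∎
      where open ≡-Reasoning

    reflectLevel : ℤ → Step × ℤ → Step × ℤ
    reflectLevel t (s , l) = (s , t - l)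

    startLevelsFrom-shift : ∀ c l w → startLevelsFrom (c + l) w ≡ map (λ (s , v) → (s , c + v)) (startLevelsFrom l w)
    startLevelsFrom-shift c l []      = refl
    startLevelsFrom-shift c l (s ∷ w) =
      cong ((s , c + l) ∷_) (trans (cong (λ z → startLevelsFrom z w) (ℤ.+-assoc c l (stepLevel s))) (startLevelsFrom-shift c (l + stepLevel s) w))

    -- Walking a word backwards from level c: the end levels of rev w are the start levels
    -- of w reflected at the total level c + T(w), in reverse order.
    levelsFrom-reverse : ∀ c w → levelsFrom a b c (reverse w) ≡ reverse (map (reflectLevel (c + totalLevel w)) (startLevelsFrom +0 w))
    levelsFrom-reverse c []      = refl
    levelsFrom-reverse c (s ∷ w) = begin
      levelsFrom a b c (reverse (s ∷ w))
        ≡⟨ cong (levelsFrom a b c) (unfold-reverse s w) ⟩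
      levelsFrom a b c (reverse w ++ s ∷ [])
        ≡⟨ levelsFrom-++ c (reverse w) (s ∷ []) ⟩
      levelsFrom a b c (reverse w) ++ levelsFrom a b (c + totalLevel (reverse w)) (s ∷ [])
        ≡⟨ cong₂ _++_ (levelsFrom-reverse c w) (last s) ⟩
      reverse (map (reflectLevel (c + totalLevel w)) (startLevelsFrom +0 w)) ++ (reflectLevel t (s , +0) ∷ [])
        ≡⟨ cong (λ z → reverse z ++ (reflectLevel t (s , +0) ∷ [])) shifted ⟩
      reverse (map (reflectLevel t) (startLevelsFrom (+0 + stepLevel s) w)) ++ (reflectLevel t (s , +0) ∷ [])
        ≡⟨ sym (unfold-reverse (reflectLevel t (s , +0)) (map (reflectLevel t) (startLevelsFrom (+0 + stepLevel s) w))) ⟩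
      reverse (map (reflectLevel t) (startLevelsFrom +0 (s ∷ w))) ∎
      where
      open ≡-Reasoning
      t : ℤ
      t = c + totalLevel (s ∷ w)
      last : ∀ s → levelsFrom a b (c + totalLevel (reverse w)) (s ∷ []) ≡ reflectLevel (c + totalLevel (s ∷ w)) (s , +0) ∷ []
      last N rewrite totalLevel-reverse w = cong (λ z → (N , z) ∷ []) (shuffle-last c (totalLevel w) (+ b))
      last E rewrite totalLevel-reverse w = cong (λ z → (E , z) ∷ []) (shuffle-last c (totalLevel w) (- + a))
      shifted : map (reflectLevel (c + totalLevel w)) (startLevelsFrom +0 w) ≡ map (reflectLevel t) (startLevelsFrom (+0 + stepLevel s) w)
      shifted = begin
        map (reflectLevel (c + totalLevel w)) (startLevelsFrom +0 w)
          ≡⟨ map-cong (λ (s′ , v) → cong (s′ ,_) (sym (shuffle-shift c (stepLevel s) (totalLevel w) v))) (startLevelsFrom +0 w) ⟩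
        map (λ p → reflectLevel t ((λ (s′ , v) → (s′ , stepLevel s + v)) p)) (startLevelsFrom +0 w)
          ≡⟨ map-∘ (startLevelsFrom +0 w) ⟩
        map (reflectLevel t) (map (λ (s′ , v) → (s′ , stepLevel s + v)) (startLevelsFrom +0 w))
          ≡⟨ cong (map (reflectLevel t)) (sym (startLevelsFrom-shift (stepLevel s) +0 w)) ⟩
        map (reflectLevel t) (startLevelsFrom (stepLevel s + +0) w)
          ≡⟨ cong (λ l → map (reflectLevel t) (startLevelsFrom l w)) (trans (ℤ.+-identityʳ (stepLevel s)) (sym (ℤ.+-identityˡ (stepLevel s)))) ⟩
        map (reflectLevel t) (startLevelsFrom (+0 + stepLevel s) w) ∎

  length-select : ∀ k ps → length (select k ps) ≡ count (λ q → proj₂ q ℤ.≟ k) ps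
  length-select k []            = refl
  length-select k ((s , l) ∷ ps) with l ℤ.≟ k
  ... | yes _ = cong suc (length-select k ps)
  ... | no _  = length-select k ps

  countN-select : ∀ k ps → countN (select k ps) ≡ count (λ q → isN? (proj₁ q) ×-dec (proj₂ q ℤ.≟ k)) ps
  countN-select k []             = refl
  countN-select k ((s , l) ∷ ps) with l ℤ.≟ k | s
  ... | yes _ | N = cong suc (countN-select k ps)
  ... | yes _ | E = countN-select k ps
  ... | no _  | N = countN-select k ps
  ... | no _  | E = countN-select k ps

  countE-select : ∀ k ps → countE (select k ps) ≡ count (λ q → isE? (proj₁ q) ×-dec (proj₂ q ℤ.≟ k)) ps
  countE-select k []             = refl
  countE-select k ((s , l) ∷ ps) with l ℤ.≟ k | s
  ... | yes _ | N = countE-select k ps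
  ... | yes _ | E = cong suc (countE-select k ps)
  ... | no _  | N = countE-select k ps
  ... | no _  | E = countE-select k ps

  module EastOfNorth (a b : ℕ) where

    eastLevel-∈ : ∀ x y w {h} → Any (λ l → + h ≡ l) (eastLevelsFrom a b x y w) →
      ∃[ x′ ] ∃[ y′ ] ((N , x′ , y′) ∈ stepsFrom x y w × + h ≡ + (b ℕ.* y′) - + (a ℕ.* suc x′))
    eastLevel-∈ x y (N ∷ w) (here eq) = x , y , here refl , eq
    eastLevel-∈ x y (N ∷ w) (there h∈) with eastLevel-∈ x (suc y) w h∈
    ... | x′ , y′ , N∈ , eq = x′ , y′ , there N∈ , eq
    eastLevel-∈ x y (E ∷ w) h∈ with eastLevel-∈ (suc x) y w h∈
    ... | x′ , y′ , N∈ , eq = x′ , y′ , there N∈ , eq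

    eastLevel-∈⁺ : ∀ x y w {h x′ y′} → (N , x′ , y′) ∈ stepsFrom x y w → + h ≡ + (b ℕ.* y′) - + (a ℕ.* suc x′) →
      Any (λ l → + h ≡ l) (eastLevelsFrom a b x y w)
    eastLevel-∈⁺ x y (N ∷ w) (here refl) eq = here eq
    eastLevel-∈⁺ x y (N ∷ w) (there N∈)  eq = there (eastLevel-∈⁺ x (suc y) w N∈ eq)
    eastLevel-∈⁺ x y (E ∷ w) (here ())   eq
    eastLevel-∈⁺ x y (E ∷ w) (there N∈)  eq = eastLevel-∈⁺ (suc x) y w N∈ eq

module Geometry where

  open import Defs using (N; E; Word; wordAux; squaresFrom; squaresRow)
  open Paths
  open Squares using (squaresFrom-∈; squaresFrom-∈⁺; squaresRow-∈; squaresRow-distinct; equal-differences)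
  open Lattice using (module LevelCollision)
  open Counting using (count; count-atMostOne)
  open import Data.Nat
  open import Data.Nat.Properties
  open import Data.Nat.Coprimality using (Coprime)
  open import Data.List using (List; []; _∷_; length)
  open import Data.List.Relation.Unary.All as All using (All; []; _∷_)
  open import Data.List.Relation.Unary.AllPairs using (AllPairs; []; _∷_)
  import Data.List.Relation.Unary.AllPairs.Properties as AllPairs
  open import Data.List.Membership.Propositional using (_∈_)
  open import Data.Product using (_×_; _,_; proj₁; proj₂; ∃-syntax)
  open import Data.Sum using (_⊎_; inj₁; inj₂)
  open import Data.Empty using (⊥; ⊥-elim)
  open import Relation.Nullary using (Dec)
  open import Relation.Binary.PropositionalEquality

  -- A path of 𝒟_{b,−a}(a,b), given by its parts listed bottom to top (padded to a parts).
  record Setting : Set where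
    field
      a b       : ℕ
      a>0       : 0 < a
      b>0       : 0 < b
      coprime   : Coprime a b
      parts     : List ℕ
      #parts    : length parts ≡ a
      ascending : AllPairs _≤_ (0 ∷ parts)
      parts≤b   : All (_≤ b) parts
    u : Word
    u = wordAux b 0 parts
    steps : List Point
    steps = stepsFrom 0 0 u
    field
      start-nonneg : ∀ {s x y} → (s , x , y) ∈ steps → a * x ≤ b * y
      end-nonneg   : ∀ {x y} → (E , x , y) ∈ steps → a * suc x ≤ b * y

  module PathGeometry (S : Setting) where
    open Setting S public
    open LevelCollision a b a>0 coprime public

    Q P : ℕ → ℕ
    Q = rowEnd b parts
    P = rowStart b 0 parts

    Q≤b : ∀ d → Q d ≤ b
    Q≤b = go parts parts≤b
      where
      go : ∀ qs → All (_≤ b) qs → ∀ d → rowEnd b qs d ≤ b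
      go []       _            d       = ≤-refl
      go (q ∷ qs) (q≤b ∷ _)    zero    = q≤b
      go (q ∷ qs) (_ ∷ qs≤b)   (suc d) = go qs qs≤b d

    Q-mono : ∀ {d d′} → d ≤ d′ → Q d ≤ Q d′
    Q-mono = go parts (tail ascending) parts≤b
      where
      tail : ∀ {v vs} → AllPairs _≤_ (v ∷ vs) → AllPairs _≤_ vs
      tail (_ ∷ rest) = rest
      lower : ∀ qs d {v} → All (v ≤_) qs → v ≤ b → v ≤ rowEnd b qs d
      lower []       d       _           v≤b = v≤b
      lower (q ∷ qs) zero    (v≤q ∷ _)   _   = v≤q
      lower (q ∷ qs) (suc d) (_ ∷ v≤qs)  v≤b = lower qs d v≤qs v≤b
      go : ∀ qs → AllPairs _≤_ qs → All (_≤ b) qs → ∀ {d d′} → d ≤ d′ → rowEnd b qs d ≤ rowEnd b qs d′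
      go []       _              _            _          = ≤-refl
      go (q ∷ qs) _              _            {zero}  {zero}   _  = ≤-refl
      go (q ∷ qs) (q≤qs ∷ _)     (q≤b ∷ _)    {zero}  {suc d′} _  = lower qs d′ q≤qs q≤b
      go (q ∷ qs) (_ ∷ asc)      (_ ∷ qs≤b)   {suc d} {suc d′} (s≤s le) = go qs asc qs≤b le

    east-step : ∀ {x y} → (E , x , y) ∈ steps → y ≤ a × P y ≤ x × x < Q y
    east-step E∈ with eastStep-∈ b 0 0 parts ascending E∈
    ... | d , refl , d≤ , start≤x , x<end = subst (d ≤_) #parts d≤ , start≤x , x<end

    north-step : ∀ {x y} → (N , x , y) ∈ steps → y < a × x ≡ Q y
    north-step N∈ with northStep-∈ b 0 0 parts ascending N∈
    ... | d , d< , refl , x≡ = subst (d <_) #parts d< , x≡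

    countN-u : countN u ≡ a
    countN-u = trans (countN-wordAux b 0 parts) #parts

    countE-u : countE u ≡ b
    countE-u = countE-wordAux b 0 parts ascending (z≤n ∷ parts≤b)

    step-inside : ∀ {s x y} → (s , x , y) ∈ steps → x ≤ b × y ≤ a × (x < b ⊎ y < a)
    step-inside {N} N∈ with north-step N∈
    ... | y<a , refl = Q≤b _ , <⇒≤ y<a , inj₂ y<a
    step-inside {E} E∈ with east-step E∈
    ... | y≤a , _ , x<Q = <⇒≤ (<-≤-trans x<Q (Q≤b _)) , y≤a , inj₁ (<-≤-trans x<Q (Q≤b _))

    level : Point → ℕ
    level (s , x , y) = b * y ∸ a * x

    -- Levels are at most ab, east steps start at level ≥ a (they end at level ≥ 0), and
    -- the level equation b·y = level + a·x holds since levels are nonnegative.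
    level-≤ : ∀ {p} → p ∈ steps → level p ≤ b * a
    level-≤ {s , x , y} p∈ = ≤-trans (m∸n≤m (b * y) (a * x)) (*-monoʳ-≤ b (proj₁ (proj₂ (step-inside p∈))))

    level-east : ∀ {x y} → (E , x , y) ∈ steps → a ≤ level (E , x , y)
    level-east {x} {y} E∈ =
      subst (_≤ b * y ∸ a * x) (trans (cong (_∸ a * x) (*-suc a x)) (m+n∸n≡m a (a * x))) (∸-monoˡ-≤ (a * x) (end-nonneg E∈))

    level-equation : ∀ {s x y} → (s , x , y) ∈ steps → b * y ≡ level (s , x , y) + a * x
    level-equation p∈ = sym (m∸n+n≡m (start-nonneg p∈))

    -- Coprimality: distinct steps start at distinct levels.
    levels-distinct : AllPairs (λ p q → level p ≢ level q) steps
    levels-distinct = go steps (All.tabulate (λ p∈ → p∈)) (stepsFrom-diagonal-< 0 0 u)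
      where
      distinct : ∀ {p q} → p ∈ steps → q ∈ steps → diagonal p < diagonal q → level p ≢ level q
      distinct {s , x , y} {s′ , x′ , y′} p∈ q∈ p<q same with step-inside p∈ | step-inside q∈
      ... | x≤b , y≤a , inside | x′≤b , y′≤a , inside′
        with level-injective x≤b y≤a x′≤b y′≤a inside inside′ equation
        where
        equation : b * y + a * x′ ≡ b * y′ + a * x
        equation = begin
          b * y + a * x′                 ≡⟨ cong (_+ a * x′) (level-equation p∈) ⟩
          level (s , x , y) + a * x + a * x′ ≡⟨ +-assoc (level (s , x , y)) (a * x) (a * x′) ⟩
          level (s , x , y) + (a * x + a * x′) ≡⟨ cong₂ _+_ same (+-comm (a * x) (a * x′)) ⟩
          level (s′ , x′ , y′) + (a * x′ + a * x) ≡⟨ sym (+-assoc (level (s′ , x′ , y′)) (a * x′) (a * x)) ⟩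
          level (s′ , x′ , y′) + a * x′ + a * x ≡⟨ cong (_+ a * x) (sym (level-equation q∈)) ⟩
          b * y′ + a * x ∎
          where open ≡-Reasoning
      ... | refl , refl = <-irrefl refl p<q
      go : ∀ ps → All (_∈ steps) ps → AllPairs (λ p q → diagonal p < diagonal q) ps → AllPairs (λ p q → level p ≢ level q) ps
      go []       []             []           = []
      go (p ∷ ps) (p∈ ∷ ps∈)     (p< ∷ rest)  = All.zipWith (λ (q∈ , p<q) → distinct p∈ q∈ p<q) (ps∈ , p<) ∷ go ps ps∈ rest

    count-at-level : ∀ {R : Point → Set} (R? : ∀ p → Dec (R p)) k → (∀ {p} → R p → level p ≡ k) → count R? steps ≤ 1
    count-at-level R? k at-k = count-atMostOne R? levels-distinct (λ Rp Rq ≢ → ≢ (trans (at-k Rp) (sym (at-k Rq))))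

    Δ : List ℕ
    Δ = squaresFrom a b 0 parts

    -- The square with lower-left corner (i , j) lies southeast of the path and has level m > 0.
    Square : ℕ → ℕ → ℕ → Set
    Square m j i = j < a × i < b × Q j ≤ i × b * j ≡ m + a * suc i × 0 < m

    Δ-∈ : ∀ {m} → m ∈ Δ → ∃[ j ] ∃[ i ] Square m j i
    Δ-∈ m∈ with squaresFrom-∈ a b 0 parts m∈
    ... | j , i , j< , i<b , Q≤i , lt , refl =
      j , i , subst (j <_) #parts j< , i<b , Q≤i , sym (m∸n+n≡m (<⇒≤ lt)) , m<n⇒0<n∸m lt

    Δ-∈⁺ : ∀ {m j i} → Square m j i → m ∈ Δ
    Δ-∈⁺ {m} {j} {i} (j<a , i<b , Q≤i , eq , m>0) =
      squaresFrom-∈⁺ a b 0 parts j i (subst (j <_) (sym #parts) j<a)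
        (i<b , Q≤i , lt , trans (sym (m+n∸n≡m m (a * suc i))) (cong (_∸ a * suc i) (sym eq)))
      where
      lt : a * suc i < b * j
      lt = subst (a * suc i <_) (sym eq) (+-monoˡ-≤ (a * suc i) m>0)

    Δ-positive : ∀ {m} → m ∈ Δ → 0 < m
    Δ-positive m∈ with Δ-∈ m∈
    ... | _ , _ , _ , _ , _ , _ , m>0 = m>0

    Δ-bound : ∀ {m} → m ∈ Δ → m < b * a
    Δ-bound {m} m∈ with Δ-∈ m∈
    ... | j , i , j<a , _ , _ , eq , _ =
      <-≤-trans (subst (m <_) (sym eq) (m<m+n m (<-≤-trans a>0 (m≤m*n a (suc i))))) (*-monoʳ-≤ b (<⇒≤ j<a))

    no-level-zero : ∀ {j i} → j < a → suc i ≤ b → b * j ≡ a * suc i → ⊥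
    no-level-zero {j} {i} j<a i<b eq
      with level-collision {suc i} {j} {0} {0} i<b (<⇒≤ j<a) z≤n a>0
             (trans (cong (b * j +_) (*-zeroʳ a)) (trans (+-identityʳ (b * j)) (trans eq (cong (_+ a * suc i) (sym (*-zeroʳ b))))))
    ... | inj₁ (() , _)
    ... | inj₂ (_ , j≡a , _) = <-irrefl j≡a j<a

    private
      lower-row : ∀ j m c → b ≤ m → b * suc j ≡ m + c → b * j ≡ (m ∸ b) + c
      lower-row j m c b≤m eq = +-cancelˡ-≡ b (b * j) (m ∸ b + c)
        (trans (sym (*-suc b j)) (trans eq (trans (cong (_+ c) (sym (m+[n∸m]≡n b≤m))) (+-assoc b (m ∸ b) c))))

      lower-positive : ∀ {j i m} → j < a → suc i ≤ b → b * j ≡ (m ∸ b) + a * suc i → 0 < m ∸ b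
      lower-positive {j} {i} {m} j<a i<b eq with m ∸ b | eq
      ... | zero  | eq′ = ⊥-elim (no-level-zero j<a i<b eq′)
      ... | suc _ | _   = s≤s z≤n

    square-not-east-end : ∀ {m j i x y} → Square m j i → (E , x , y) ∈ steps → b * y ≡ m + a * suc x → ⊥
    square-not-east-end {m} {j} {i} {x} {y} (j<a , i<b , Q≤i , eq , _) E∈ end with east-step E∈
    ... | y≤a , _ , x<Q with level-collision {suc x} {y} {suc i} {j} (≤-trans x<Q (Q≤b y)) y≤a i<b j<a equation
      where
      equation : b * y + a * suc i ≡ b * j + a * suc x
      equation = begin
        b * y + a * suc i             ≡⟨ cong (_+ a * suc i) end ⟩
        m + a * suc x + a * suc i     ≡⟨ +-assoc m (a * suc x) (a * suc i) ⟩
        m + (a * suc x + a * suc i)   ≡⟨ cong (m +_) (+-comm (a * suc x) (a * suc i)) ⟩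
        m + (a * suc i + a * suc x)   ≡⟨ sym (+-assoc m (a * suc i) (a * suc x)) ⟩
        m + a * suc i + a * suc x     ≡⟨ cong (_+ a * suc x) (sym eq) ⟩
        b * j + a * suc x             ∎
        where open ≡-Reasoning
    ... | inj₁ (refl , refl) = <-irrefl refl (≤-<-trans Q≤i x<Q)
    ... | inj₂ (_ , _ , () , _)

    square-below : ∀ {m j i} → Square m j i → b ≤ m → (m ∸ b) ∈ Δ
    square-below {m} {zero} (_ , _ , _ , eq , m>0) b≤m =
      ⊥-elim (<-irrefl refl (<-≤-trans m>0 (subst (m ≤_) (trans (sym eq) (*-zeroʳ b)) (m≤m+n m _))))
    square-below {m} {suc j} {i} (j<a , i<b , Q≤i , eq , _) b≤m =
      Δ-∈⁺ (<-trans (n<1+n j) j<a , i<b , ≤-trans (Q-mono (n≤1+n j)) Q≤i , eq′ , lower-positive (<-trans (n<1+n j) j<a) i<b eq′)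
      where
      eq′ : b * j ≡ (m ∸ b) + a * suc i
      eq′ = lower-row j m (a * suc i) b≤m eq

    square-below-east-end : ∀ {m x y} → (E , x , y) ∈ steps → b * y ≡ m + a * suc x → b ≤ m → (m ∸ b) ∈ Δ
    square-below-east-end {m} {x} {zero} _ end b≤m =
      ⊥-elim (<-irrefl refl (<-≤-trans (<-≤-trans b>0 b≤m) (subst (m ≤_) (trans (sym end) (*-zeroʳ b)) (m≤m+n m _))))
    square-below-east-end {m} {x} {suc j} E∈ end b≤m with east-step E∈
    ... | j<a , P≤x , x<Q =
      Δ-∈⁺ (j<a , x<b , P≤x , eq′ , lower-positive j<a x<b eq′)
      where
      x<b : x < b
      x<b = <-≤-trans x<Q (Q≤b (suc j))
      eq′ : b * j ≡ (m ∸ b) + a * suc x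
      eq′ = lower-row j m (a * suc x) b≤m end

    square-east-of-north : ∀ {h x y} → (N , x , y) ∈ steps → b * y ≡ (a + h) + a * x → 0 < h → h ∈ Δ
    square-east-of-north {h} {x} {y} N∈ start h>0 with north-step N∈
    ... | y<a , refl = Δ-∈⁺ (y<a , Q<b , ≤-refl , eq , h>0)
      where
      eq : b * y ≡ h + a * suc (Q y)
      eq = trans start (trans (cong (_+ a * Q y) (+-comm a h)) (trans (+-assoc h a (a * Q y)) (cong (h +_) (sym (*-suc a (Q y))))))
      a[Q+1]<ab : a * suc (Q y) < a * b
      a[Q+1]<ab = <-≤-trans (subst (a * suc (Q y) <_) (sym eq) (+-monoˡ-≤ (a * suc (Q y)) h>0))
                            (subst (b * y ≤_) (*-comm b a) (*-monoʳ-≤ b (<⇒≤ y<a)))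
      Q<b : Q y < b
      Q<b = <-trans (n<1+n (Q y)) (*-cancelˡ-< a (suc (Q y)) b a[Q+1]<ab)

    -- Distinct squares below the top row have distinct levels, so Δᶜ has no repetitions.
    Δ-distinct : AllPairs (λ v w → v ≢ w) Δ
    Δ-distinct = rows 0 parts #parts
      where
      rows : ∀ j₀ qs → j₀ + length qs ≡ a → AllPairs (λ v w → v ≢ w) (squaresFrom a b j₀ qs)
      rows j₀ []       _     = []
      rows j₀ (q ∷ qs) total =
        AllPairs.++⁺ (squaresRow-distinct a b j₀ q) (rows (suc j₀) qs (trans (sym (+-suc j₀ (length qs))) total))
          (All.tabulate (λ v∈ → All.tabulate (λ w∈ → across v∈ w∈)))
        where
        j₀<a : j₀ < a
        j₀<a = subst (j₀ <_) total (m<m+n j₀ (s≤s z≤n))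
        across : ∀ {v w} → v ∈ squaresRow a b j₀ q → w ∈ squaresFrom a b (suc j₀) qs → v ≢ w
        across v∈ w∈ refl with squaresRow-∈ a b j₀ q v∈ | squaresFrom-∈ a b (suc j₀) qs w∈
        ... | i , i<b , _ , lt , v≡ | d , i′ , d< , i′<b , _ , lt′ , w≡
          with level-collision {suc i} {j₀} {suc i′} {suc j₀ + d} i<b (<⇒≤ j₀<a) i′<b higher<a
                 (equal-differences lt lt′ v≡ w≡)
          where
          higher<a : suc j₀ + d < a
          higher<a = subst (suc j₀ + d <_) total (subst (_≤ j₀ + suc (length qs)) (trans (+-suc j₀ (suc d)) (cong suc (+-suc j₀ d))) (+-monoʳ-≤ j₀ (s≤s d<)))
        ... | inj₁ (_ , j₀≡) = <-irrefl j₀≡ (s≤s (m≤m+n j₀ d))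
        ... | inj₂ (_ , j₀≡a , _) = <-irrefl j₀≡a j₀<a

-- The key identity: a kept row of ζ with first-column hook h has exactly as many cells as
-- there are east steps of u starting below level h + a.
module KeyIdentity (S : Geometry.Setting) where

  open import Defs using (E)
  open Counting
  open Paths using (isN?; isE?; count-E-stepsFrom)
  open Windows
  open import Data.Nat
  open import Data.Nat.Properties
  open import Data.Nat.Tactic.RingSolver using (solve-∀)
  open import Data.List.Membership.DecPropositional _≟_ using (_∈?_)
  open import Data.List.Membership.Propositional using (_∈_)
  open import Data.List.Relation.Unary.All as All using (All)
  open import Data.Product using (_×_; _,_; proj₁; proj₂)
  open import Data.Sum using (_⊎_; inj₁; inj₂; [_,_])
  open import Data.Empty using (⊥)
  open import Function using (_⇔_; mk⇔)
  open import Relation.Nullary using (Dec; yes; no; ¬_; ¬?; _×-dec_)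
  open import Relation.Binary.PropositionalEquality hiding ([_])
  open import Algebra.Properties.CommutativeSemigroup +-commutativeSemigroup using (x∙yz≈xz∙y)

  open Geometry.PathGeometry S

  northAt eastAt eastsBelow : ℕ → ℕ
  northAt    k = count (λ p → isN? (proj₁ p) ×-dec (level p ≟ k)) steps
  eastAt     k = count (λ p → isE? (proj₁ p) ×-dec (level p ≟ k)) steps
  eastsBelow k = count (λ p → isE? (proj₁ p) ×-dec (level p <? k)) steps

  -- By coprimality at most one step starts at any level.
  northAt≤1 : ∀ k → northAt k ≤ 1
  northAt≤1 k = count-at-level _ k proj₂

  eastAt≤1 : ∀ k → eastAt k ≤ 1
  eastAt≤1 k = count-at-level _ k proj₂

  eastsBelow-step : ∀ k → eastsBelow (suc k) ≡ eastsBelow k + eastAt k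
  eastsBelow-step k = trans
    (sumBy-cong {xs = steps} (All.tabulate (λ {p} _ →
      χ-split (isE? (proj₁ p)) (level p <? suc k) (level p <? k) (level p ≟ k) (below-or-at (level p)) (λ l<k l≡k → <-irrefl l≡k l<k))))
    (sumBy-+ _ _ steps)
    where
    below-or-at : ∀ l → (l < suc k) ⇔ (l < k ⊎ l ≡ k)
    below-or-at l = mk⇔ split [ m<n⇒m<1+n , (λ { refl → ≤-refl }) ]
      where
      split : l < suc k → l < k ⊎ l ≡ k
      split l<1+k with l ≟ k
      ... | yes l≡k = inj₂ l≡k
      ... | no l≢k  = inj₁ (≤∧≢⇒< (≤-pred l<1+k) l≢k)

  -- East steps starting at level m + a are those ending at level m.
  eastAt-ends : ∀ m → (∀ {x y} → (E , x , y) ∈ steps → b * y ≡ m + a * suc x → ⊥) → eastAt (m + a) ≡ 0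
  eastAt-ends m no-end = sumBy-zero (All.tabulate (λ {p} p∈ → χ-false (isE? (proj₁ p) ×-dec (level p ≟ m + a)) (ends p∈)))
    where
    ends : ∀ {p} → p ∈ steps → ¬ (proj₁ p ≡ E × level p ≡ m + a)
    ends {E , x , y} E∈ (refl , at) = no-end E∈ (begin
      b * y                ≡⟨ level-equation E∈ ⟩
      level (E , x , y) + a * x ≡⟨ cong (_+ a * x) at ⟩
      m + a + a * x        ≡⟨ +-assoc m a (a * x) ⟩
      m + (a + a * x)      ≡⟨ cong (m +_) (sym (*-suc a x)) ⟩
      m + a * suc x        ∎)
      where open ≡-Reasoning

  gaps : ℕ → ℕ
  gaps = windowGaps (_∈? Δ) b

  -- Local comparison at level m: an east step ending at level m needs m ∉ Δᶜ, and then
  -- forbids the square below (level m − b) from leaving the window as a gap.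
  eastAt-bound : ∀ m → eastAt (m + a) + gapLeaving (_∈? Δ) b m ≤ gap (_∈? Δ) b m
  eastAt-bound m = cases (m ∈? Δ) ((b ≤? m) ×-dec ¬? ((m ∸ b) ∈? Δ))
    where
    cases : (dΔ : Dec (m ∈ Δ)) (dL : Dec ((b ≤ m) × ¬ (m ∸ b) ∈ Δ)) → eastAt (m + a) + χ dL ≤ χ (¬? dΔ)
    cases (yes m∈) dL with Δ-∈ m∈
    ... | j , i , sq = ≤-reflexive (cong₂ _+_ (eastAt-ends m (square-not-east-end sq))
                                              (χ-false dL (λ (b≤m , m-b∉) → m-b∉ (square-below sq b≤m))))
    cases (no m∉) (no _) = subst (_≤ 1) (sym (+-identityʳ _)) (eastAt≤1 (m + a))
    cases (no m∉) (yes (b≤m , m-b∉)) = ≤-reflexive (cong (_+ 1) (eastAt-ends m (λ E∈ end → m-b∉ (square-below-east-end E∈ end b≤m))))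

  increment-bound : ∀ m → gaps m + eastsBelow (suc m + a) ≤ gaps (suc m) + eastsBelow (m + a)
  increment-bound m = begin
    gaps m + eastsBelow (suc (m + a))                  ≡⟨ cong (gaps m +_) (eastsBelow-step (m + a)) ⟩
    gaps m + (eastsBelow (m + a) + eastAt (m + a))     ≡⟨ x∙yz≈xz∙y (gaps m) (eastsBelow (m + a)) (eastAt (m + a)) ⟩
    gaps m + eastAt (m + a) + eastsBelow (m + a)       ≤⟨ +-monoˡ-≤ (eastsBelow (m + a)) step ⟩
    gaps (suc m) + eastsBelow (m + a)                  ∎
    where
    open ≤-Reasoning
    step : gaps m + eastAt (m + a) ≤ gaps (suc m)
    step = +-cancelʳ-≤ (gapLeaving (_∈? Δ) b m) _ _ (begin
      gaps m + eastAt (m + a) + gapLeaving (_∈? Δ) b m   ≡⟨ +-assoc (gaps m) (eastAt (m + a)) _ ⟩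
      gaps m + (eastAt (m + a) + gapLeaving (_∈? Δ) b m) ≤⟨ +-monoʳ-≤ (gaps m) (eastAt-bound m) ⟩
      gaps m + gap (_∈? Δ) b m                            ≡⟨ sym (windowGaps-step (_∈? Δ) b b>0 m) ⟩
      gaps (suc m) + gapLeaving (_∈? Δ) b m              ∎)

  difference-monotone : ∀ m k → gaps m + eastsBelow (k + m + a) ≤ gaps (k + m) + eastsBelow (m + a)
  difference-monotone m zero    = ≤-refl
  difference-monotone m (suc k) =
    +-cancelˡ-≤ (C + B) (A + D) (E′ + F)
      (≤-trans (≤-reflexive (shuffle₁ A B C D)) (≤-trans (+-mono-≤ (difference-monotone m k) (increment-bound (k + m))) (≤-reflexive (shuffle₂ C F E′ B))))
    where
    A B C D E′ F : ℕ
    A = gaps m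
    B = eastsBelow (k + m + a)
    C = gaps (k + m)
    D = eastsBelow (suc (k + m) + a)
    E′ = gaps (suc (k + m))
    F = eastsBelow (m + a)
    shuffle₁ : ∀ A B C D → (C + B) + (A + D) ≡ (A + B) + (C + D)
    shuffle₁ = solve-∀
    shuffle₂ : ∀ C F E′ B → (C + F) + (E′ + B) ≡ (C + B) + (E′ + F)
    shuffle₂ = solve-∀

  eastsBelow-small : ∀ k → k ≤ a → eastsBelow k ≡ 0
  eastsBelow-small k k≤a = sumBy-zero (All.tabulate (λ {p} p∈ → χ-false (isE? (proj₁ p) ×-dec (level p <? k)) (high p∈)))
    where
    high : ∀ {p} → p ∈ steps → ¬ (proj₁ p ≡ E × level p < k)
    high {E , x , y} E∈ (refl , lt) = <-irrefl refl (<-≤-trans lt (≤-trans k≤a (level-east E∈)))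

  top : ℕ
  top = b * a + b

  eastsBelow-all : ∀ K → b * a < K → eastsBelow K ≡ b
  eastsBelow-all K ab<K = trans
    (sumBy-cong {xs = steps} (All.tabulate (λ {p} p∈ →
      χ-cong (mk⇔ proj₁ (λ isE → isE , ≤-<-trans (level-≤ p∈) ab<K)) (isE? (proj₁ p) ×-dec (level p <? K)) (isE? (proj₁ p)))))
    (trans (count-E-stepsFrom 0 0 u) countE-u)

  gaps≡eastsBelow : ∀ h → h ≤ top → gaps h ≡ eastsBelow (h + a)
  gaps≡eastsBelow h h≤top = ≤-antisym upper lower
    where
    lower : eastsBelow (h + a) ≤ gaps h
    lower = subst₂ _≤_ (cong (λ k → eastsBelow (k + a)) (+-identityʳ h))
                       (trans (cong₂ _+_ (cong gaps (+-identityʳ h)) (eastsBelow-small a ≤-refl)) (+-identityʳ (gaps h)))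
                       (difference-monotone 0 h)
    upper : gaps h ≤ eastsBelow (h + a)
    upper = +-cancelʳ-≤ b (gaps h) (eastsBelow (h + a))
      (subst₂ _≤_ (cong (gaps h +_) (trans (cong (λ k → eastsBelow (k + a)) (m∸n+n≡m h≤top)) (eastsBelow-all (top + a) ab<top+a)))
                  (trans (cong (_+ eastsBelow (h + a)) (trans (cong gaps (m∸n+n≡m h≤top)) (windowGaps-beyond (_∈? Δ) b (b * a) Δ-bound)))
                         (+-comm b (eastsBelow (h + a))))
                  (difference-monotone h (top ∸ h)))
      where
      ab<top+a : b * a < top + a
      ab<top+a = <-≤-trans (m<m+n (b * a) b>0) (m≤m+n top a)

-- The sw⁺ side: sw⁺(rev u) lists the steps of u by increasing start level.
module SwSide (S : Geometry.Setting) where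

  open import Defs using (Step; Word; wordAux; levelsFrom; select; swPlus; rev)
  open Counting
  open Paths
  open Levels
  open KeyIdentity S
  open import Data.Nat
  open import Data.Nat.Properties
  open import Data.Integer as ℤ using (ℤ; +_; -[1+_]; +0)
  import Data.Integer.Properties as ℤ
  open import Data.List using (List; []; _++_; length; replicate; reverse; map; concatMap; upTo)
  open import Data.List.Properties using (++-identityʳ; concatMap-map; map-upTo; concatMap-cong; length-reverse)
  open import Data.List.Relation.Unary.All as All using (All)
  open import Data.List.Membership.Propositional using (_∈_)
  open import Data.Product using (_×_; _,_; proj₁; proj₂)
  open import Function using (_∘_; mk⇔)
  open import Relation.Nullary using (Dec; _×-dec_)
  open import Relation.Binary.PropositionalEquality

  open Geometry.PathGeometry S
  open AtSlope a b

  totalLevel-u : totalLevel u ≡ +0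
  totalLevel-u rewrite totalLevel-counts u | countN-u | countE-u | *-comm b a = ℤ.+-inverseʳ (+ (a * b))

  -- The end levels along rev u, and how counting over them reduces to counting over the
  -- steps of u: walking backwards, the step starting at level l is met at level −l.
  revLevels : List (Step × ℤ)
  revLevels = levelsFrom a b +0 (reverse u)

  sumBy-revLevels : ∀ (f : Step × ℤ → ℕ) → sumBy f revLevels ≡ sumBy (λ p → f (proj₁ p , ℤ.- (+ level p))) steps
  sumBy-revLevels f = begin
    sumBy f revLevels
      ≡⟨ cong (sumBy f) (levelsFrom-reverse +0 u) ⟩
    sumBy f (reverse (map (reflectLevel t) (startLevelsFrom +0 u)))
      ≡⟨ sumBy-reverse f (map (reflectLevel t) (startLevelsFrom +0 u)) ⟩
    sumBy f (map (reflectLevel t) (startLevelsFrom +0 u))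
      ≡⟨ cong (λ z → sumBy f (map (reflectLevel t) z)) starts ⟩
    sumBy f (map (reflectLevel t) (map withStartLevel steps))
      ≡⟨ trans (sumBy-map f (reflectLevel t) (map withStartLevel steps)) (sumBy-map (f ∘ reflectLevel t) withStartLevel steps) ⟩
    sumBy (λ p → f (reflectLevel t (withStartLevel p))) steps
      ≡⟨ sumBy-cong {xs = steps} (All.tabulate (λ {p} p∈ → cong f (reflected p∈))) ⟩
    sumBy (λ p → f (proj₁ p , ℤ.- (+ level p))) steps ∎
    where
    open ≡-Reasoning
    t : ℤ
    t = +0 ℤ.+ totalLevel u
    starts : startLevelsFrom +0 u ≡ map withStartLevel steps
    starts = subst (λ l → startLevelsFrom l u ≡ map withStartLevel steps) pointLevel-origin (startLevelsFrom-stepsFrom 0 0 u)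
    reflected : ∀ {p} → p ∈ steps → reflectLevel t (withStartLevel p) ≡ (proj₁ p , ℤ.- (+ level p))
    reflected {s , x , y} p∈ rewrite totalLevel-u =
      cong (s ,_) (trans (ℤ.+-identityˡ _) (cong ℤ.-_ (difference-∸ (start-nonneg p∈))))

  -- The letters of rev u ending at level −k: the step of u starting at level k, if any.
  block : ℕ → Word
  block k = select (ℤ.- (+ k)) revLevels

  private
    at-level : ∀ {P : Set} (d : Dec P) k p → χ (d ×-dec (ℤ.- (+ level p) ℤ.≟ ℤ.- (+ k))) ≡ χ (d ×-dec (level p ≟ k))
    at-level d k p = χ-cong (mk⇔ (λ (x , eq) → x , neg-injective eq) (λ (x , eq) → x , cong (λ z → ℤ.- (+ z)) eq)) _ _

  block-short : ∀ k → length (block k) ≤ 1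
  block-short k = subst (_≤ 1) (sym (begin
    length (block k)
      ≡⟨ length-select (ℤ.- (+ k)) revLevels ⟩
    count (λ q → proj₂ q ℤ.≟ ℤ.- (+ k)) revLevels
      ≡⟨ sumBy-revLevels (λ q → χ (proj₂ q ℤ.≟ ℤ.- (+ k))) ⟩
    sumBy (λ p → χ (ℤ.- (+ level p) ℤ.≟ ℤ.- (+ k))) steps
      ≡⟨ sumBy-cong {xs = steps} (All.tabulate (λ {p} _ → χ-cong (mk⇔ neg-injective (cong (λ z → ℤ.- (+ z)))) _ (level p ≟ k))) ⟩
    count (λ p → level p ≟ k) steps ∎))
    (count-at-level (λ p → level p ≟ k) k (λ eq → eq))
    where open ≡-Reasoning

  countN-block : ∀ k → countN (block k) ≡ northAt k
  countN-block k = trans (countN-select (ℤ.- (+ k)) revLevels)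
    (trans (sumBy-revLevels _) (sumBy-cong {xs = steps} (All.tabulate (λ {p} _ → at-level (isN? (proj₁ p)) k p))))

  countE-block : ∀ k → countE (block k) ≡ eastAt k
  countE-block k = trans (countE-select (ℤ.- (+ k)) revLevels)
    (trans (sumBy-revLevels _) (sumBy-cong {xs = steps} (All.tabulate (λ {p} _ → at-level (isE? (proj₁ p)) k p))))

  select-positive : ∀ m → select (+ suc m) revLevels ≡ []
  select-positive m = empty (trans (length-select (+ suc m) revLevels)
    (trans (sumBy-revLevels _) (sumBy-zero {xs = steps} (All.tabulate (λ {p} _ → χ-false (ℤ.- (+ level p) ℤ.≟ + suc m) neg≢pos)))))
    where
    empty : ∀ {A : Set} {xs : List A} → length xs ≡ 0 → xs ≡ []
    empty {xs = []} _ = refl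

  blocksBelow : ℕ → Word
  blocksBelow K = concatMap block (upTo K)

  countE-blocksBelow : ∀ K → countE (blocksBelow K) ≡ eastsBelow K
  countE-blocksBelow zero    = sym (eastsBelow-small 0 z≤n)
  countE-blocksBelow (suc K) = begin
    countE (blocksBelow (suc K))                  ≡⟨ cong countE (concatMap-upTo-suc block K) ⟩
    countE (blocksBelow K ++ block K)             ≡⟨ countE-++ (blocksBelow K) (block K) ⟩
    countE (blocksBelow K) + countE (block K)     ≡⟨ cong₂ _+_ (countE-blocksBelow K) (countE-block K) ⟩
    eastsBelow K + eastAt K                     ≡⟨ sym (eastsBelow-step K) ⟩
    eastsBelow (suc K)                            ∎
    where open ≡-Reasoning

  scanned : ℕ
  scanned = suc (a * length (rev u))

  scanned-large : suc a + b * a ≤ scanned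
  scanned-large = s≤s (subst (a + b * a ≤_) (sym (cong (a *_) length-rev-u))
    (subst (a + b * a ≤_) (sym (*-distribˡ-+ a a b)) (+-mono-≤ (m≤m*n a a) (≤-reflexive (*-comm b a)))))
    where
    instance _ = a≢0
    length-rev-u : length (rev u) ≡ a + b
    length-rev-u = trans (length-reverse u) (trans (length-countN-countE u) (cong₂ _+_ countN-u countE-u))

  swPlus-blocks : swPlus a b (rev u) ≡ blocksBelow scanned
  swPlus-blocks = begin
    select +0 revLevels ++ concatMap (λ m → select -[1+ m ] revLevels) (upTo K) ++ concatMap (λ m → select (+ suc m) revLevels) (reverse (upTo K′))
      ≡⟨ cong (λ z → select +0 revLevels ++ concatMap (λ m → select -[1+ m ] revLevels) (upTo K) ++ z)
              (concatMap-empty _ (reverse (upTo K′)) (All.tabulate (λ {m} _ → select-positive m))) ⟩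
    select +0 revLevels ++ concatMap (block ∘ suc) (upTo K) ++ []
      ≡⟨ cong (select +0 revLevels ++_) (++-identityʳ _) ⟩
    select +0 revLevels ++ concatMap (block ∘ suc) (upTo K)
      ≡⟨ cong (select +0 revLevels ++_) (sym (concatMap-map block suc (upTo K))) ⟩
    select +0 revLevels ++ concatMap block (map suc (upTo K))
      ≡⟨ cong (λ z → select +0 revLevels ++ concatMap block z) (map-upTo suc K) ⟩
    blocksBelow scanned ∎
    where
    open ≡-Reasoning
    K K′ : ℕ
    K  = a * length (rev u)
    K′ = b * length (rev u)

  eastCountsBelow : ℕ → List ℕ
  eastCountsBelow K = concatMap (λ k → replicate (northAt k) (eastsBelow k)) (upTo K)

  swPlus-word : swPlus a b (rev u) ≡ wordAux b 0 (eastCountsBelow scanned)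
  swPlus-word = begin
    swPlus a b (rev u)                                ≡⟨ swPlus-blocks ⟩
    blocksBelow scanned                               ≡⟨ sym (wordAux-eastCounts b 0 0 (blocksBelow scanned) z≤n (countE-blocksBelow-all)) ⟩
    wordAux b 0 (eastCounts 0 (blocksBelow scanned))  ≡⟨ cong (wordAux b 0) eastCounts-blocks′ ⟩
    wordAux b 0 (eastCountsBelow scanned)             ∎
    where
    open ≡-Reasoning
    countE-blocksBelow-all : countE (blocksBelow scanned) ≡ b
    countE-blocksBelow-all = trans (countE-blocksBelow scanned) (eastsBelow-all scanned ab<scanned)
      where
      ab<scanned : b * a < scanned
      ab<scanned = <-≤-trans (s≤s (m≤n+m (b * a) a)) scanned-large
    eastCounts-blocks′ : eastCounts 0 (blocksBelow scanned) ≡ eastCountsBelow scanned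
    eastCounts-blocks′ = trans (eastCounts-blocks block block-short scanned)
      (concatMap-cong (λ k → cong₂ replicate (countN-block k) (countE-blocksBelow k)) (upTo scanned))

module ZetaSide (S : Geometry.Setting) where

  open import Defs using (N; sortDesc; zetaRows; eastLevelsFrom)
  open Counting
  open Sorting
  open Paths using (countN; isN?; count-N-stepsFrom)
  open Levels using (difference⁻; difference⁺; module EastOfNorth)
  open Hooks using (ν; module ZetaRows)
  open KeyIdentity S
  open SwSide S using (scanned; scanned-large; eastCountsBelow)
  open import Data.Nat
  open import Data.Nat.Properties
  open import Data.Integer as ℤ using (ℤ)
  open import Data.List using (List; _++_; length; replicate; reverse; map; filter; concatMap; upTo)
  open import Data.List.Properties
  open import Data.List.Relation.Unary.All as All using (All)
  open import Data.List.Relation.Unary.Any using (Any)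
  import Data.List.Relation.Unary.Any.Properties as Any
  import Data.List.Relation.Unary.AllPairs.Properties as AllPairs
  open import Data.List.Membership.Propositional using (_∈_)
  open import Data.List.Membership.Propositional.Properties using (∈-filter⁺; ∈-filter⁻; ∈-upTo⁻)
  open import Data.List.Membership.DecPropositional _≟_ using (_∈?_)
  open import Data.Product using (_×_; _,_; proj₁; ∃-syntax)
  open import Function using (_∘_; _⇔_; mk⇔; Equivalence)
  open import Relation.Nullary using (Dec; yes; no; ¬_; _×-dec_)
  open import Relation.Binary.PropositionalEquality

  open Geometry.PathGeometry S
  open EastOfNorth a b

  levelsEastOfNorth : List ℤ
  levelsEastOfNorth = eastLevelsFrom a b 0 0 u

  hooks : List ℕ
  hooks = sortDesc Δ

  open ZetaRows (_∈? Δ) b levelsEastOfNorth using (kept?; zetaRows-ν)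

  ζrows : List ℕ
  ζrows = zetaRows b levelsEastOfNorth (ν hooks)

  hooks-descending : Descending hooks
  hooks-descending = sortDesc-descending Δ Δ-distinct

  ζrows-kept : ζrows ≡ map gaps (filter kept? hooks)
  ζrows-kept = zetaRows-ν hooks hooks-descending
    (All.tabulate (λ h∈ → Δ-positive (Equivalence.to (sortDesc-∈ Δ _) h∈)))
    (All.tabulate (λ _ g _ → sortDesc-∈ Δ g))

  NorthAt : ℕ → Set
  NorthAt k = ∃[ x ] ∃[ y ] ((N , x , y) ∈ steps × b * y ≡ k + a * x)

  private
    shift-a : ∀ h x → h + a * suc x ≡ a + h + a * x
    shift-a h x = trans (cong (λ t → h + t) (*-suc a x)) (trans (sym (+-assoc h a (a * x))) (cong (_+ a * x) (+-comm h a)))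

  kept⇒north : ∀ {h} → Any (λ l → ℤ.+ h ≡ l) levelsEastOfNorth → NorthAt (a + h)
  kept⇒north {h} kept with eastLevel-∈ 0 0 u kept
  ... | x , y , N∈ , eq = x , y , N∈ , trans (difference⁻ (sym eq)) (shift-a h x)

  north⇒kept : ∀ {h} → NorthAt (a + h) → Any (λ l → ℤ.+ h ≡ l) levelsEastOfNorth
  north⇒kept {h} (x , y , N∈ , eq) = eastLevel-∈⁺ 0 0 u N∈ (sym (difference⁺ (trans eq (sym (shift-a h x)))))

  northAt-present : ∀ {k} → NorthAt k → northAt k ≡ 1
  northAt-present {k} (x , y , N∈ , eq) = ≤-antisym (northAt≤1 k)
    (count-member (λ p → isN? (proj₁ p) ×-dec (level p ≟ k)) N∈ (refl , trans (cong (_∸ a * x) eq) (m+n∸n≡m k (a * x))))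

  northAt-absent : ∀ {k} → ¬ NorthAt k → northAt k ≡ 0
  northAt-absent {k} none = sumBy-zero (All.tabulate (λ {p} p∈ → χ-false (isN? (proj₁ p) ×-dec (level p ≟ k)) (not-here p∈)))
    where
    not-here : ∀ {p} → p ∈ steps → ¬ (proj₁ p ≡ N × level p ≡ k)
    not-here {N , x , y} N∈ (refl , at) = none (x , y , N∈ , trans (level-equation N∈) (cong (_+ a * x) at))

  northAt-high : ∀ k → b * a < k → northAt k ≡ 0
  northAt-high k ab<k = sumBy-zero (All.tabulate (λ {p} p∈ →
    χ-false (isN? (proj₁ p) ×-dec (level p ≟ k)) (λ (_ , at) → <-irrefl at (≤-<-trans (level-≤ p∈) ab<k))))

  keptHook? : ∀ h → Dec (h ∈ Δ × Any (λ l → ℤ.+ h ≡ l) levelsEastOfNorth)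
  keptHook? h = (h ∈? Δ) ×-dec kept? h

  keptRow-block : ∀ h′ → replicate (χ (keptHook? (suc h′))) (gaps (suc h′)) ≡ replicate (northAt (suc a + h′)) (eastsBelow (suc a + h′))
  keptRow-block h′ with keptHook? (suc h′)
  ... | yes (h∈ , kept) = cong₂ replicate
    (sym (northAt-present (subst NorthAt (+-suc a h′) (kept⇒north kept))))
    (trans (gaps≡eastsBelow (suc h′) (≤-trans (<⇒≤ (Δ-bound h∈)) (m≤m+n (b * a) b))) (cong eastsBelow (cong suc (+-comm h′ a))))
  ... | no ¬keptHook =
    sym (cong (λ n → replicate n (eastsBelow (suc a + h′))) (northAt-absent (λ north → ¬keptHook (kept-hook (shift north)))))
    where
    shift : NorthAt (suc a + h′) → NorthAt (a + suc h′)
    shift = subst NorthAt (sym (+-suc a h′))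
    kept-hook : NorthAt (a + suc h′) → suc h′ ∈ Δ × Any (λ l → ℤ.+ suc h′ ≡ l) levelsEastOfNorth
    kept-hook north@(x , y , N∈ , eq) = square-east-of-north N∈ eq (s≤s z≤n) , north⇒kept north

  keptHook-rows : ℕ → List ℕ
  keptHook-rows h = replicate (χ (keptHook? h)) (gaps h)

  reverse-ζrows : reverse ζrows ≡ concatMap (keptHook-rows ∘ suc) (upTo (b * a))
  reverse-ζrows = begin
    reverse ζrows                                     ≡⟨ cong reverse ζrows-kept ⟩
    reverse (map gaps (filter kept? hooks))           ≡⟨ sym (reverse-map gaps (filter kept? hooks)) ⟩
    map gaps (reverse (filter kept? hooks))           ≡⟨ cong (map gaps) (sym (filter-reverse kept? hooks)) ⟩
    map gaps (filter kept? (reverse hooks))           ≡⟨ cong (map gaps) (sym ascending-kept) ⟩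
    map gaps (filter keptHook? (upTo (suc (b * a))))  ≡⟨ map-filter keptHook? gaps (upTo (suc (b * a))) ⟩
    concatMap keptHook-rows (upTo (suc (b * a)))      ≡⟨ cong (keptHook-rows 0 ++_) (trans (cong (concatMap keptHook-rows) (sym (map-upTo suc (b * a)))) (concatMap-map keptHook-rows suc (upTo (b * a)))) ⟩
    keptHook-rows 0 ++ concatMap (keptHook-rows ∘ suc) (upTo (b * a))
      ≡⟨ cong (λ n → replicate n (gaps 0) ++ concatMap (keptHook-rows ∘ suc) (upTo (b * a)))
              (χ-false (keptHook? 0) (λ (0∈ , _) → <-irrefl refl (Δ-positive 0∈))) ⟩
    concatMap (keptHook-rows ∘ suc) (upTo (b * a)) ∎
    where
    open ≡-Reasoning
    kept-∈ : ∀ {h} → h ∈ filter kept? (reverse hooks) ⇔ (h ∈ Δ × Any (λ l → ℤ.+ h ≡ l) levelsEastOfNorth)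
    kept-∈ = mk⇔
      (λ h∈ → let (h∈hooks , kept) = ∈-filter⁻ kept? {xs = reverse hooks} h∈
              in Equivalence.to (sortDesc-∈ Δ _) (Any.reverse⁻ h∈hooks) , kept)
      (λ (h∈ , kept) → ∈-filter⁺ kept? (Any.reverse⁺ (Equivalence.from (sortDesc-∈ Δ _) h∈)) kept)
    ascending-kept : filter keptHook? (upTo (suc (b * a))) ≡ filter kept? (reverse hooks)
    ascending-kept = filter-upTo-unique keptHook? (suc (b * a)) (filter kept? (reverse hooks))
      (AllPairs.filter⁺ kept? (AllPairs-reverse hooks-descending))
      (All.tabulate (λ h∈ → s≤s (<⇒≤ (Δ-bound (proj₁ (Equivalence.to kept-∈ h∈))))))
      (λ h _ → mk⇔ (Equivalence.from kept-∈) (Equivalence.to kept-∈))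

  highBlocks : List ℕ
  highBlocks = concatMap (λ h′ → replicate (northAt (suc a + h′)) (eastsBelow (suc a + h′))) (upTo (b * a))

  reverse-ζrows-blocks : reverse ζrows ≡ highBlocks
  reverse-ζrows-blocks = trans reverse-ζrows (concatMap-cong keptRow-block (upTo (b * a)))

  low : ℕ
  low = sumBelow northAt (suc a)

  low-blocks : eastCountsBelow (suc a) ≡ replicate low 0
  low-blocks = trans (concatMap-replicate-zero northAt eastsBelow (upTo (suc a)) (All.tabulate (λ k∈ → eastsBelow-small _ (≤-pred (∈-upTo⁻ k∈)))))
                     (cong (λ n → replicate n 0) (sumBy-upTo northAt (suc a)))

  northAt-total : sumBelow northAt (suc a + b * a) ≡ a
  northAt-total = begin
    sumBelow northAt (suc a + b * a)
      ≡⟨ sumBelow-sumBy (λ k p → χ (isN? (proj₁ p) ×-dec (level p ≟ k))) steps (suc a + b * a) ⟩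
    sumBy (λ p → sumBelow (λ k → χ (isN? (proj₁ p) ×-dec (level p ≟ k))) (suc a + b * a)) steps
      ≡⟨ sumBy-cong {xs = steps} (All.tabulate (λ {p} p∈ → trans (sumBelow-point (isN? (proj₁ p)) (level p) (suc a + b * a))
           (χ-cong (mk⇔ proj₁ (λ isN → isN , ≤-<-trans (level-≤ p∈) (s≤s (m≤n+m (b * a) a)))) _ (isN? (proj₁ p))))) ⟩
    count (λ p → isN? (proj₁ p)) steps
      ≡⟨ count-N-stepsFrom 0 0 u ⟩
    countN u
      ≡⟨ countN-u ⟩
    a ∎
    where open ≡-Reasoning

  length-ζrows : length ζrows ≡ sumBelow (λ h′ → northAt (suc a + h′)) (b * a)
  length-ζrows = begin
    length ζrows              ≡⟨ sym (length-reverse ζrows) ⟩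
    length (reverse ζrows)    ≡⟨ cong length reverse-ζrows-blocks ⟩
    length highBlocks         ≡⟨ length-concatMap-replicate (λ h′ → northAt (suc a + h′)) _ (upTo (b * a)) ⟩
    sumBy (λ h′ → northAt (suc a + h′)) (upTo (b * a))
                              ≡⟨ sumBy-upTo _ (b * a) ⟩
    sumBelow (λ h′ → northAt (suc a + h′)) (b * a) ∎
    where open ≡-Reasoning

  low≡ : low ≡ a ∸ length ζrows
  low≡ = sym (begin
    a ∸ length ζrows                                                          ≡⟨ cong (_∸ length ζrows) (sym northAt-total) ⟩
    sumBelow northAt (suc a + b * a) ∸ length ζrows                           ≡⟨ cong (_∸ length ζrows) (sumBelow-split northAt (suc a) (b * a)) ⟩
    low + sumBelow (λ h′ → northAt (suc a + h′)) (b * a) ∸ length ζrows       ≡⟨ cong (λ n → low + n ∸ length ζrows) (sym length-ζrows) ⟩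
    low + length ζrows ∸ length ζrows                                         ≡⟨ m+n∸n≡m low (length ζrows) ⟩
    low ∎)
    where open ≡-Reasoning

  padded-ζrows : reverse (ζrows ++ replicate (a ∸ length ζrows) 0) ≡ eastCountsBelow scanned
  padded-ζrows = begin
    reverse (ζrows ++ replicate (a ∸ length ζrows) 0)
      ≡⟨ reverse-++ ζrows (replicate (a ∸ length ζrows) 0) ⟩
    reverse (replicate (a ∸ length ζrows) 0) ++ reverse ζrows
      ≡⟨ cong₂ _++_ (trans (reverse-replicate (a ∸ length ζrows) 0) (cong (λ n → replicate n 0) (sym low≡))) reverse-ζrows-blocks ⟩
    replicate low 0 ++ highBlocks
      ≡⟨ cong (_++ highBlocks) (sym low-blocks) ⟩
    eastCountsBelow (suc a) ++ highBlocks
      ≡⟨ cong (eastCountsBelow (suc a) ++_) (sym (concatMap-map (λ k → replicate (northAt k) (eastsBelow k)) (suc a +_) (upTo (b * a)))) ⟩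
    eastCountsBelow (suc a) ++ concatMap (λ k → replicate (northAt k) (eastsBelow k)) (map (suc a +_) (upTo (b * a)))
      ≡⟨ sym (concatMap-++ (λ k → replicate (northAt k) (eastsBelow k)) (upTo (suc a)) _) ⟩
    concatMap (λ k → replicate (northAt k) (eastsBelow k)) (upTo (suc a) ++ map (suc a +_) (upTo (b * a)))
      ≡⟨ cong (concatMap _) (sym (upTo-+ (suc a) (b * a))) ⟩
    eastCountsBelow (suc a + b * a)
      ≡⟨ sym (trans (cong eastCountsBelow (sym (m+[n∸m]≡n scanned-large)))
                    (concatMap-upTo-stable _ (suc a + b * a) (scanned ∸ (suc a + b * a))
                       (λ k ≥ → cong (λ n → replicate n (eastsBelow k)) (northAt-high k (<-≤-trans (s≤s (m≤n+m (b * a) a)) ≥))))) ⟩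
    eastCountsBelow scanned ∎
    where open ≡-Reasoning

module Construction where

  open import Defs
  open Sorting using (AllPairs-reverse; All-reverse)
  open Paths using (stepsFrom)
  open Levels using (difference-nonnegative; module AtSlope)
  open Geometry using (Setting)
  open import Data.Nat
  open import Data.Nat.Properties
  open import Data.Nat.GCD using (gcd)
  open import Data.Nat.Coprimality using (gcd≡1⇒coprime)
  open import Data.Integer as ℤ using (ℤ)
  open import Data.List using (List; []; _∷_; length; replicate; reverse)
  open import Data.List.Properties using (length-reverse; length-++; length-replicate)
  open import Data.List.Relation.Unary.All as All using (All; []; _∷_)
  import Data.List.Relation.Unary.All.Properties as All
  open import Data.List.Relation.Unary.AllPairs using (AllPairs; []; _∷_)
  import Data.List.Relation.Unary.AllPairs.Properties as AllPairs
  open import Data.List.Relation.Unary.Linked.Properties using (Linked⇒AllPairs)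
  open import Data.Product using (_,_; proj₂)
  open import Relation.Binary.PropositionalEquality

  starts-nonneg : ∀ a b x y w → a * x ≤ b * y →
    All (λ p → ℤ.+ 0 ℤ.≤ proj₂ (AtSlope.withEndLevel a b p)) (stepsFrom x y w) →
    All (λ (s , x′ , y′) → a * x′ ≤ b * y′) (stepsFrom x y w)
  starts-nonneg a b x y []      _     _            = []
  starts-nonneg a b x y (N ∷ w) start (end ∷ ends) = start ∷ starts-nonneg a b x (suc y) w (difference-nonnegative end) ends
  starts-nonneg a b x y (E ∷ w) start (end ∷ ends) = start ∷ starts-nonneg a b (suc x) y w (difference-nonnegative end) ends

  setting : (a b : ℕ) → 0 < a → 0 < b → gcd a b ≡ 1 → (π : List ℕ) → InD a b π → Setting
  setting a b a>0 b>0 gcd≡1 π (box , nonneg) = record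
    { a = a ; b = b ; a>0 = a>0 ; b>0 = b>0 ; coprime = gcd≡1⇒coprime gcd≡1
    ; parts = parts
    ; #parts = #parts
    ; ascending = All.tabulate (λ _ → z≤n) ∷ AllPairs-reverse padded-descending
    ; parts≤b = All-reverse (All.++⁺ shortRows (All.replicate⁺ (a ∸ length π) z≤n))
    ; start-nonneg = λ p∈ → All.lookup (starts-nonneg a b 0 0 u origin end-levels) p∈
    ; end-nonneg = λ E∈ → difference-nonnegative (All.lookup end-levels E∈)
    }
    where
    open BoxPartition box
    open AtSlope a b
    parts : List ℕ
    parts = reverse (padded a π)
    u : Word
    u = wordAux b 0 parts
    #parts : length parts ≡ a
    #parts = trans (length-reverse (padded a π))
      (trans (length-++ π) (trans (cong (length π +_) (length-replicate (a ∸ length π))) (m+[n∸m]≡n fewRows)))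
    padded-descending : AllPairs (λ x y → y ≤ x) (padded a π)
    padded-descending = AllPairs.++⁺ (Linked⇒AllPairs (λ y≤x z≤y → ≤-trans z≤y y≤x) decreasing)
      (zeros (a ∸ length π)) (All.tabulate (λ _ → All.replicate⁺ (a ∸ length π) z≤n))
      where
      zeros : ∀ n → AllPairs (λ x y → y ≤ x) (replicate n 0)
      zeros zero    = []
      zeros (suc n) = All.replicate⁺ n z≤n ∷ zeros n
    origin : a * 0 ≤ b * 0
    origin = subst₂ _≤_ (sym (*-zeroʳ a)) (sym (*-zeroʳ b)) z≤n
    end-levels : All (λ p → ℤ.+ 0 ℤ.≤ proj₂ (withEndLevel p)) (stepsFrom 0 0 u)
    end-levels = All.map⁻ (subst (All (λ p → ℤ.+ 0 ℤ.≤ proj₂ p))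
      (trans (cong (λ l → levelsFrom a b l u) (sym pointLevel-origin)) (levelsFrom-stepsFrom 0 0 u)) nonneg)

theorem4p8 : (a b : ℕ) → 0 < a → 0 < b → gcd a b ≡ 1 →
    (π : List ℕ) → InD a b π →
    word a b (ζ a b π) ≡ swPlus a b (rev (word a b π))
theorem4p8 a b a>0 b>0 gcd≡1 π inD = begin
  word a b (ζ a b π)                                       ≡⟨ cong (wordAux b 0) (ZetaSide.padded-ζrows S) ⟩
  wordAux b 0 (SwSide.eastCountsBelow S (SwSide.scanned S)) ≡⟨ sym (SwSide.swPlus-word S) ⟩
  swPlus a b (rev (word a b π))                            ∎
  where
  open ≡-Reasoning
  S : Geometry.Setting
  S = Construction.setting a b a>0 b>0 gcd≡1 π inD
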